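{- Let $G$ be an $n$-vertex graph. (a) $\nu(G)\le\eta(G)$. (b) $\nu(G)\le\sum_{v\in V(G)}\nu(G-v)$. (c) If $G$ is the disjoint union of graphs $G_1,\dots,G_r$ with $n_1,\dots,n_r$ vertices, then $\nu(G)=\binom{n}{n_1,\dots,n_r}\prod_{i=1}^r\nu(G_i)$. (d) If $G$ is the join of graphs $G_1,\dots,G_r$ with $n_1,\dots,n_r$ vertices, then $\nu(G)=\left|\begin{bmatrix} n\\ n_1,\dots,n_r\end{bmatrix}_{ -1}\right|\prod_{i=1}^r\nu(G_i)$. (e) If $G=G_1\circ_v G_2$ with $|V(G_i)|=n_i$, then $\nu(G)=\frac{1}{n_1!}\binom{n_1n_2}{n_2,\dots,n_2}\nu(G_1)\nu(G_2)^{n_1}$ (the multinomial has $n_1$ lower entries equal to $n_2$).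
   Context: For an $N$-vertex digraph $D$, a descent of a bijection $\sigma:V(D)\to[N]$ is an arc $u\to w$ with $\sigma(u)>\sigma(w)$, and $A_D(t)=\sum_\sigma t^{\mathrm{des}_D(\sigma)}$ where $\mathrm{des}_D(\sigma)$ counts descents. For a graph $G$, $\nu(G):=|A_D(-1)|$ for any orientation $D$ of $G$ (independent of orientation). An ordering $(\pi_1,\dots,\pi_N)$ of $V(G)$ is an even sequence if each $G[\{\pi_1,\dots,\pi_i\}]$ has an even number of edges; $\eta(G)$ is their number. The join of vertex-disjoint graphs $G_1,\dots,G_r$ is their disjoint union plus all edges between vertices of distinct $G_i$. The rooted product $G_1\circ_v G_2$ ($v\in V(G_2)$) is obtained by attaching to each vertex $x$ of $G_1$ a separate copy of $G_2$, identifying the copy of $v$ with $x$. $\begin{bmatrix} n\\ n_1,\dots,n_r\end{bmatrix}_t=\frac{[n]_t!}{[n_1]_t!\cdots[n_r]_t!}$ with $[k]_t!=\prod_{j=1}^k(1+t+\cdots+t^{j-1})$. -}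

module Defs where

open import Data.Bool using (Bool; true; false; _∧_; _∨_; not; if_then_else_)
open import Data.Bool.Properties using (∧-zeroʳ; ∨-comm; ∧-comm)
open import Data.Nat as ℕ using (ℕ; zero; suc; _%_; _≡ᵇ_)
open import Data.Fin as Fin using (Fin; toℕ; splitAt; remQuot; punchIn)
open import Data.Fin.Properties using (_≟_)
open import Data.Integer as ℤ using (ℤ)
open import Data.List using (List; []; _∷_; map; filter; concatMap; allFin; foldr; replicate; length; upTo)
open import Data.Nat.ListAction using (sum)
open import Data.List.Relation.Unary.All using (All)
open import Data.Product using (Σ; _×_; _,_; proj₁; proj₂)
open import Data.Sum using (_⊎_; inj₁; inj₂)
open import Relation.Nullary using (yes; no)
open import Relation.Nullary.Decidable using (⌊_⌋)
open import Relation.Binary.PropositionalEquality using (_≡_; refl; sym; cong)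

record Graph (n : ℕ) : Set where
  field
    adj    : Fin n → Fin n → Bool
    adj-sym : ∀ u w → adj u w ≡ adj w u
    irrefl : ∀ u → adj u u ≡ false
open Graph public

Digraph : ℕ → Set
Digraph n = Fin n → Fin n → Bool

-- A fixed orientation of G: each edge {u,w} is oriented from the smaller
-- to the larger index.  (ν does not depend on the orientation.)
orient : ∀ {n} → Graph n → Digraph n
orient G u w = adj G u w ∧ (toℕ u ℕ.<ᵇ toℕ w)

allFuns : ∀ n m → List (Fin n → Fin m)
allFuns zero    m = (λ ()) ∷ []
allFuns (suc n) m =
  concatMap (λ a → map (λ g → λ { Fin.zero → a ; (Fin.suc i) → g i })
                       (allFuns n m))
            (allFin m)

_≟ᵇ_ : ∀ {n} → Fin n → Fin n → Bool
x ≟ᵇ y = ⌊ x ≟ y ⌋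

count : ∀ {A : Set} → (A → Bool) → List A → ℕ
count p []       = 0
count p (x ∷ xs) = (if p x then 1 else 0) ℕ.+ count p xs

pairs : ∀ n → List (Fin n × Fin n)
pairs n = concatMap (λ u → map (λ w → (u , w)) (allFin n)) (allFin n)

allᵇ : ∀ {A : Set} → (A → Bool) → List A → Bool
allᵇ p = foldr (λ x b → p x ∧ b) true

isInjᵇ : ∀ {n} → (Fin n → Fin n) → Bool
isInjᵇ {n} σ = allᵇ (λ { (u , w) → not (σ u ≟ᵇ σ w) ∨ (u ≟ᵇ w) }) (pairs n)

bijections : ∀ n → List (Fin n → Fin n)
bijections n = filter (λ σ → isInjᵇ σ Data.Bool.≟ true) (allFuns n n)

des : ∀ {n} → Digraph n → (Fin n → Fin n) → ℕ
des {n} D σ = count (λ { (u , w) → D u w ∧ (toℕ (σ w) ℕ.<ᵇ toℕ (σ u)) }) (pairs n)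

A : ∀ {n} → Digraph n → ℤ → ℤ
A {n} D t = foldr ℤ._+_ (ℤ.+ 0) (map (λ σ → t ℤ.^ des D σ) (bijections n))

ν : ∀ {n} → Graph n → ℕ
ν G = ℤ.∣ A (orient G) (ℤ.- (ℤ.+ 1)) ∣

-- Even sequences and η
-- An ordering (π_1,…,π_n) of V(G) is a bijection π : Fin n → Fin n
-- (π i = the vertex in position i).

-- number of edges of G[{π_1,…,π_i}]  (pairs of positions a < b < i)
prefixEdges : ∀ {n} → Graph n → (Fin n → Fin n) → ℕ → ℕ
prefixEdges {n} G π i =
  count (λ { (a , b) → (toℕ a ℕ.<ᵇ toℕ b) ∧ (toℕ b ℕ.<ᵇ i) ∧ adj G (π a) (π b) })
        (pairs n)

isEvenSeqᵇ : ∀ {n} → Graph n → (Fin n → Fin n) → Bool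
isEvenSeqᵇ {n} G π = allᵇ (λ i → (prefixEdges G π i % 2) ≡ᵇ 0) (upTo (suc n))

η : ∀ {n} → Graph n → ℕ
η {n} G = count (isEvenSeqᵇ G) (bijections n)

deleteV : ∀ {m} → Graph (suc m) → Fin (suc m) → Graph m
deleteV G v = record
  { adj    = λ a b → adj G (punchIn v a) (punchIn v b)
  ; adj-sym = λ a b → adj-sym G (punchIn v a) (punchIn v b)
  ; irrefl = λ a → irrefl G (punchIn v a)
  }

-- Disjoint union and join (binary, then iterated)
-- vertices of the first graph are Fin a ↑ˡ b, of the second a ↑ʳ Fin b

twoAdj : ∀ {a b} → Bool → Graph a → Graph b → Fin a ⊎ Fin b → Fin a ⊎ Fin b → Bool
twoAdj c G H (inj₁ x) (inj₁ y) = adj G x y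
twoAdj c G H (inj₂ x) (inj₂ y) = adj H x y
twoAdj c G H (inj₁ x) (inj₂ y) = c
twoAdj c G H (inj₂ x) (inj₁ y) = c

twoAdj-sym : ∀ {a b} c (G : Graph a) (H : Graph b) s t →
             twoAdj c G H s t ≡ twoAdj c G H t s
twoAdj-sym c G H (inj₁ x) (inj₁ y) = adj-sym G x y
twoAdj-sym c G H (inj₂ x) (inj₂ y) = adj-sym H x y
twoAdj-sym c G H (inj₁ x) (inj₂ y) = refl
twoAdj-sym c G H (inj₂ x) (inj₁ y) = refl

twoAdj-irr : ∀ {a b} c (G : Graph a) (H : Graph b) s → twoAdj c G H s s ≡ false
twoAdj-irr c G H (inj₁ x) = irrefl G x
twoAdj-irr c G H (inj₂ x) = irrefl H x

-- c = false : disjoint union ; c = true : join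
combine2 : ∀ {a b} → Bool → Graph a → Graph b → Graph (a ℕ.+ b)
combine2 {a} c G H = record
  { adj    = λ u w → twoAdj c G H (splitAt a u) (splitAt a w)
  ; adj-sym = λ u w → twoAdj-sym c G H (splitAt a u) (splitAt a w)
  ; irrefl = λ u → twoAdj-irr c G H (splitAt a u)
  }

emptyGraph : Graph 0
emptyGraph = record { adj = λ () ; adj-sym = λ () ; irrefl = λ () }

totalSize : List (Σ ℕ Graph) → ℕ
totalSize Gs = sum (map proj₁ Gs)

combineAll : Bool → (Gs : List (Σ ℕ Graph)) → Graph (totalSize Gs)
combineAll c []             = emptyGraph
combineAll c ((n , G) ∷ Gs) = combine2 c G (combineAll c Gs)

disjointUnion : (Gs : List (Σ ℕ Graph)) → Graph (totalSize Gs)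
disjointUnion = combineAll false

join : (Gs : List (Σ ℕ Graph)) → Graph (totalSize Gs)
join = combineAll true

-- Rooted product G₁ ∘_v G₂ on Fin (n₁ * n₂):
-- vertex (x , y) = copy of y ∈ V(G₂) attached at x ∈ V(G₁); (x , v) is x.

≟ᵇ-sym : ∀ {n} (x y : Fin n) → (x ≟ᵇ y) ≡ (y ≟ᵇ x)
≟ᵇ-sym x y with x ≟ y | y ≟ x
... | yes _ | yes _ = refl
... | no  _ | no  _ = refl
... | yes p | no ¬q = Data.Empty.⊥-elim (¬q (sym p))
  where import Data.Empty
... | no ¬p | yes q = Data.Empty.⊥-elim (¬p (sym q))
  where import Data.Empty

pairAdj : ∀ {n₁ n₂} → Graph n₁ → Graph n₂ → Fin n₂ →
          Fin n₁ × Fin n₂ → Fin n₁ × Fin n₂ → Bool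
pairAdj G₁ G₂ v (x , y) (x' , y') =
  ((x ≟ᵇ x') ∧ adj G₂ y y') ∨ (((y ≟ᵇ v) ∧ (y' ≟ᵇ v)) ∧ adj G₁ x x')

pairAdj-sym : ∀ {n₁ n₂} (G₁ : Graph n₁) (G₂ : Graph n₂) v p q →
              pairAdj G₁ G₂ v p q ≡ pairAdj G₁ G₂ v q p
pairAdj-sym G₁ G₂ v (x , y) (x' , y')
  rewrite ≟ᵇ-sym x x' | adj-sym G₂ y y' | adj-sym G₁ x x' | ∧-comm (y ≟ᵇ v) (y' ≟ᵇ v)
  = refl

pairAdj-irr : ∀ {n₁ n₂} (G₁ : Graph n₁) (G₂ : Graph n₂) v p →
              pairAdj G₁ G₂ v p p ≡ false
pairAdj-irr G₁ G₂ v (x , y)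
  rewrite irrefl G₂ y | irrefl G₁ x
        | ∧-zeroʳ (x ≟ᵇ x) | ∧-zeroʳ ((y ≟ᵇ v) ∧ (y ≟ᵇ v)) = refl

rootedProduct : ∀ {n₁ n₂} → Graph n₁ → Graph n₂ → Fin n₂ → Graph (n₁ ℕ.* n₂)
rootedProduct {n₁} {n₂} G₁ G₂ v = record
  { adj    = λ p q → pairAdj G₁ G₂ v (remQuot n₂ p) (remQuot n₂ q)
  ; adj-sym = λ p q → pairAdj-sym G₁ G₂ v (remQuot n₂ p) (remQuot n₂ q)
  ; irrefl = λ p → pairAdj-irr G₁ G₂ v (remQuot n₂ p)
  }

-- Integer polynomials as coefficient lists (constant term first)

Poly : Set
Poly = List ℤ

_+ₚ_ : Poly → Poly → Poly
[]       +ₚ q        = q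
(a ∷ p)  +ₚ []       = a ∷ p
(a ∷ p)  +ₚ (b ∷ q)  = (a ℤ.+ b) ∷ (p +ₚ q)

_*ₚ_ : Poly → Poly → Poly
[]      *ₚ q = []
(a ∷ p) *ₚ q = map (a ℤ.*_) q +ₚ (ℤ.+ 0 ∷ (p *ₚ q))

coeff : Poly → ℕ → ℤ
coeff []      k       = ℤ.+ 0
coeff (a ∷ p) zero    = a
coeff (a ∷ p) (suc k) = coeff p k

_≈ₚ_ : Poly → Poly → Set
p ≈ₚ q = ∀ k → coeff p k ≡ coeff q k

evalP : Poly → ℤ → ℤ
evalP []      t = ℤ.+ 0
evalP (a ∷ p) t = a ℤ.+ t ℤ.* evalP p t

oneP : Poly
oneP = ℤ.+ 1 ∷ []

productP : List Poly → Poly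
productP = foldr _*ₚ_ oneP

qInt : ℕ → Poly
qInt k = replicate k (ℤ.+ 1)

qFact : ℕ → Poly
qFact zero    = oneP
qFact (suc k) = qInt (suc k) *ₚ qFact k

-- Write A₋₁ G = Σ_σ (-1)^des(σ) = A_D(-1), so that ν G = ∣ A₋₁ G ∣. Sorting the bijections by the vertex p
-- labelled first gives the vertex recursion A₋₁ G = Σ_p (-1)^d(p) A₋₁ (G - p), where d(p) counts the neighbours
-- of p of smaller index; (b) is its triangle inequality. Composing with the reversal of the labels turns des
-- into |E| - des, so A₋₁ G = 0 when |E| is odd; when |E| is even, splitting the even sequences by their last
-- vertex gives η G = Σ_v η (G - v), and (a) follows from (b) by induction.
-- Applying the vertex recursion to both parts of a disjoint union or a join shows, by induction on the sizes
-- and the q-Pascal rule, that A₋₁ of the combination is A₋₁ G₁ · A₋₁ G₂ times the Gaussian binomial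
-- coefficient [n₁ + n₂ choose n₁]_t at t = 1, respectively t = -1. Since [n]_t! is this coefficient times
-- [n₁]_t! [n₂]_t!, this gives (c) and (d).
-- For (e), relabelling the n₁ copies of G₂ by a permutation α of V(G₁) keeps the descents inside the copies
-- and permutes the roots, so averaging over α gives n₁! A₋₁ (G₁ ∘ᵥ G₂) = A₋₁ (n₁ G₂) · A₋₁ G₁, where n₁ G₂,
-- the disjoint union of n₁ copies of G₂, is handled by (c).

module Submission where

open import Defs

open import Algebra.Bundles using (AbelianGroup)
open import Data.Bool using (Bool; true; false; _∧_; _∨_; not; if_then_else_)
open import Data.Bool.Properties using (∧-assoc; ∧-zeroʳ; ∧-identityʳ; ∧-comm; ∨-identityʳ; ∨-zeroʳ; T-≡)
open import Data.Empty using (⊥; ⊥-elim)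
open import Data.Fin as Fin using (Fin; toℕ; punchIn; punchOut; _↑ˡ_; _↑ʳ_; opposite; fromℕ; fromℕ<; splitAt; combine; remQuot)
import Data.Fin.Permutation as Perm
import Data.Fin.Properties as FinP
open import Data.Fin.Subset using (Subset; _∈_; _∉_) renaming (∣_∣ to ∣_∣ˢ)
open import Data.Fin.Subset.Properties using (∈⊤; ∣⊤∣≡n; p⊂q⇒∣p∣<∣q∣)
open import Data.Integer as ℤ using (ℤ; +_; -_; ∣_∣; 0ℤ; 1ℤ; -1ℤ)
import Data.Integer.Properties as ℤP
open import Data.Integer.Tactic.RingSolver using (solve-∀)
open import Data.List using (List; []; _∷_; map; filter; concatMap; allFin; foldr; _++_; tabulate; upTo; replicate)
open import Data.List.Properties using (map-cong; map-replicate; upTo-∷ʳ)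
open import Data.Nat as ℕ using (ℕ; zero; suc; _<ᵇ_; _∸_; _%_; _≡ᵇ_; _!; _*_; _^_; _≤_)
open import Data.Nat.ListAction using (sum; product)
import Data.Nat.Properties as ℕP
open import Data.Product using (Σ; _×_; _,_; proj₁; proj₂; ∃)
open import Data.Sum using (inj₁; inj₂)
import Data.Vec as Vec
open import Data.Vec.Properties using (lookup∘tabulate; lookup⇒[]=; []=⇒lookup)
open import Function.Bundles using (Equivalence)
open import Function.Definitions using (Injective)
open import Level using (0ℓ)
open import Relation.Binary.Bundles using (Setoid)
open import Relation.Binary.Definitions using (tri<; tri≈; tri>)
open import Relation.Binary.PropositionalEquality
import Relation.Binary.Reasoning.Setoid
open import Relation.Nullary using (yes; no; Dec; isYes)

open import Algebra.Properties.CommutativeSemigroup ℤP.+-commutativeSemigroup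
  using () renaming (interchange to +-interchange; x∙yz≈y∙xz to +-exchange)
open import Algebra.Properties.Group (AbelianGroup.group ℤP.+-0-abelianGroup)
  using () renaming (∙-cancelˡ to ℤ+-cancelˡ)
open import Algebra.Properties.Semiring.Sum ℤP.+-*-semiring
  using (sum-syntax; sum-cong-≗; ∑-distrib-+; ∑-comm; *-distribˡ-sum; sum-remove; sum-replicate-zero; ∑-permute)

-- Finite sums

𝟙 : Bool → ℤ
𝟙 true  = 1ℤ
𝟙 false = 0ℤ

-- A fold of the mapped list, so that A_D(t) is literally such a sum.
listSum : ∀ {X : Set} → List X → (X → ℤ) → ℤ
listSum xs f = foldr ℤ._+_ 0ℤ (map f xs)

infixl 10 listSum
syntax listSum xs (λ x → e) = ∑[ x ∈ xs ] e

module _ {X : Set} where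

  ∑ˡ-cong : ∀ (xs : List X) {f g : X → ℤ} → (∀ x → f x ≡ g x) → listSum xs f ≡ listSum xs g
  ∑ˡ-cong []       f≗g = refl
  ∑ˡ-cong (x ∷ xs) f≗g = cong₂ ℤ._+_ (f≗g x) (∑ˡ-cong xs f≗g)

  ∑ˡ-++ : ∀ (xs ys : List X) f → listSum (xs ++ ys) f ≡ listSum xs f ℤ.+ listSum ys f
  ∑ˡ-++ []       ys f = sym (ℤP.+-identityˡ _)
  ∑ˡ-++ (x ∷ xs) ys f rewrite ∑ˡ-++ xs ys f = sym (ℤP.+-assoc (f x) _ _)

  ∑ˡ-distrib-+ : ∀ (xs : List X) f g → ∑[ x ∈ xs ] (f x ℤ.+ g x) ≡ listSum xs f ℤ.+ listSum xs g
  ∑ˡ-distrib-+ []       f g = refl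
  ∑ˡ-distrib-+ (x ∷ xs) f g rewrite ∑ˡ-distrib-+ xs f g = +-interchange (f x) (g x) _ _

  *-distribˡ-∑ˡ : ∀ (xs : List X) c f → ∑[ x ∈ xs ] (c ℤ.* f x) ≡ c ℤ.* listSum xs f
  *-distribˡ-∑ˡ []       c f = sym (ℤP.*-zeroʳ c)
  *-distribˡ-∑ˡ (x ∷ xs) c f rewrite *-distribˡ-∑ˡ xs c f = sym (ℤP.*-distribˡ-+ c (f x) _)

  ∑ˡ-zero : ∀ (xs : List X) → ∑[ x ∈ xs ] 0ℤ ≡ 0ℤ
  ∑ˡ-zero []       = refl
  ∑ˡ-zero (x ∷ xs) = trans (ℤP.+-identityˡ _) (∑ˡ-zero xs)

  ∑ˡ-neg : ∀ (xs : List X) f → ∑[ x ∈ xs ] (- f x) ≡ - listSum xs f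
  ∑ˡ-neg []       f = refl
  ∑ˡ-neg (x ∷ xs) f rewrite ∑ˡ-neg xs f = sym (ℤP.neg-distrib-+ (f x) _)

  count≡∑ˡ : ∀ (p : X → Bool) xs → + count p xs ≡ ∑[ x ∈ xs ] 𝟙 (p x)
  count≡∑ˡ p []       = refl
  count≡∑ˡ p (x ∷ xs) with p x
  ... | true  = trans (ℤP.pos-+ 1 (count p xs)) (cong (ℤ._+_ 1ℤ) (count≡∑ˡ p xs))
  ... | false = trans (count≡∑ˡ p xs) (sym (ℤP.+-identityˡ _))

  ∑ˡ-filter : ∀ (p : X → Bool) xs f →
    listSum (filter (λ x → p x Data.Bool.≟ true) xs) f ≡ ∑[ x ∈ xs ] (if p x then f x else 0ℤ)
  ∑ˡ-filter p []       f = refl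
  ∑ˡ-filter p (x ∷ xs) f with p x
  ... | true  = cong (ℤ._+_ (f x)) (∑ˡ-filter p xs f)
  ... | false = trans (∑ˡ-filter p xs f) (sym (ℤP.+-identityˡ _))

module _ {X Y : Set} where

  ∑ˡ-map : ∀ (g : X → Y) xs f → listSum (map g xs) f ≡ ∑[ x ∈ xs ] f (g x)
  ∑ˡ-map g []       f = refl
  ∑ˡ-map g (x ∷ xs) f = cong (ℤ._+_ (f (g x))) (∑ˡ-map g xs f)

  ∑ˡ-concatMap : ∀ (h : X → List Y) xs f → listSum (concatMap h xs) f ≡ ∑[ x ∈ xs ] listSum (h x) f
  ∑ˡ-concatMap h []       f = refl
  ∑ˡ-concatMap h (x ∷ xs) f =
    trans (∑ˡ-++ (h x) (concatMap h xs) f) (cong (ℤ._+_ (listSum (h x) f)) (∑ˡ-concatMap h xs f))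

  ∑ˡ-comm : ∀ (xs : List X) (ys : List Y) (F : X → Y → ℤ) →
    ∑[ x ∈ xs ] ∑[ y ∈ ys ] F x y ≡ ∑[ y ∈ ys ] ∑[ x ∈ xs ] F x y
  ∑ˡ-comm []       ys F = sym (∑ˡ-zero ys)
  ∑ˡ-comm (x ∷ xs) ys F rewrite ∑ˡ-comm xs ys F = sym (∑ˡ-distrib-+ ys (F x) _)

∑-cong : ∀ n {f g : Fin n → ℤ} → f ≗ g → ∑[ i < n ] f i ≡ ∑[ i < n ] g i
∑-cong n = sum-cong-≗ {n}

∑ˡ-tabulate : ∀ {X : Set} n (g : Fin n → X) f → listSum (tabulate g) f ≡ ∑[ i < n ] f (g i)
∑ˡ-tabulate zero    g f = refl
∑ˡ-tabulate (suc n) g f = cong (ℤ._+_ (f (g Fin.zero))) (∑ˡ-tabulate n (λ i → g (Fin.suc i)) f)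

∑ˡ-allFin : ∀ n f → listSum (allFin n) f ≡ ∑[ i < n ] f i
∑ˡ-allFin n f = ∑ˡ-tabulate n (λ i → i) f

∑ˡ-pairs : ∀ n (f : Fin n × Fin n → ℤ) → listSum (pairs n) f ≡ ∑[ u < n ] ∑[ w < n ] f (u , w)
∑ˡ-pairs n f =
  trans (∑ˡ-concatMap (λ u → map (λ w → (u , w)) (allFin n)) (allFin n) f)
        (trans (∑ˡ-allFin n _)
               (∑-cong n (λ u → trans (∑ˡ-map (λ w → (u , w)) (allFin n) f) (∑ˡ-allFin n _))))

∑-zero : ∀ n → ∑[ i < n ] 0ℤ ≡ 0ℤ
∑-zero n = sum-replicate-zero n

∑-const : ∀ n k → ∑[ i < n ] k ≡ + n ℤ.* k
∑-const zero    k = sym (ℤP.*-zeroˡ k)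
∑-const (suc n) k = trans (cong (ℤ._+_ k) (∑-const n k)) (sym (ℤP.suc-* (+ n) k))

∑-↑ : ∀ a b (h : Fin (a ℕ.+ b) → ℤ) → ∑[ i < a ℕ.+ b ] h i ≡ ∑[ i < a ] h (i ↑ˡ b) ℤ.+ ∑[ j < b ] h (a ↑ʳ j)
∑-↑ zero    b h = sym (ℤP.+-identityˡ _)
∑-↑ (suc a) b h rewrite ∑-↑ a b (λ i → h (Fin.suc i)) = sym (ℤP.+-assoc (h Fin.zero) _ _)

∑-combine : ∀ m n (h : Fin (m ℕ.* n) → ℤ) → ∑[ p < m ℕ.* n ] h p ≡ ∑[ x < m ] ∑[ y < n ] h (combine x y)
∑-combine zero    n h = refl
∑-combine (suc m) n h =
  trans (∑-↑ n (m ℕ.* n) h) (cong (ℤ._+_ (∑[ y < n ] h (y ↑ˡ m ℕ.* n))) (∑-combine m n (λ i → h (n ↑ʳ i))))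

∑-if : ∀ n (b : Bool) (f : Fin n → ℤ) → ∑[ i < n ] (if b then f i else 0ℤ) ≡ (if b then ∑[ i < n ] f i else 0ℤ)
∑-if n true  f = refl
∑-if n false f = ∑-zero n

≟ᵇ⇒≡ : ∀ {n} {x y : Fin n} → (x ≟ᵇ y) ≡ true → x ≡ y
≟ᵇ⇒≡ {x = x} {y} e with x FinP.≟ y
... | yes x≡y = x≡y

≡⇒≟ᵇ : ∀ {n} {x y : Fin n} → x ≡ y → (x ≟ᵇ y) ≡ true
≡⇒≟ᵇ {x = x} refl with x FinP.≟ x
... | yes _  = refl
... | no x≢x = ⊥-elim (x≢x refl)

≢⇒≟ᵇ : ∀ {n} {x y : Fin n} → x ≢ y → (x ≟ᵇ y) ≡ false
≢⇒≟ᵇ {x = x} {y} x≢y with x FinP.≟ y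
... | yes x≡y = ⊥-elim (x≢y x≡y)
... | no _    = refl

bool-ext : ∀ {b c : Bool} → (b ≡ true → c ≡ true) → (c ≡ true → b ≡ true) → b ≡ c
bool-ext {true}  {true}  f g = refl
bool-ext {true}  {false} f g = sym (f refl)
bool-ext {false} {true}  f g = g refl
bool-ext {false} {false} f g = refl

≟ᵇ-cong : ∀ {n m} {x y : Fin n} {x′ y′ : Fin m} → (x ≡ y → x′ ≡ y′) → (x′ ≡ y′ → x ≡ y) → (x ≟ᵇ y) ≡ (x′ ≟ᵇ y′)
≟ᵇ-cong to from = bool-ext (λ e → ≡⇒≟ᵇ (to (≟ᵇ⇒≡ e))) (λ e → ≡⇒≟ᵇ (from (≟ᵇ⇒≡ e)))

∧-true⁻ : ∀ {b c : Bool} → (b ∧ c) ≡ true → (b ≡ true) × (c ≡ true)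
∧-true⁻ {true} {true} e = refl , refl

∧-true : ∀ {b c : Bool} → b ≡ true → c ≡ true → (b ∧ c) ≡ true
∧-true refl refl = refl

𝟙-∧ : ∀ b c → 𝟙 (b ∧ c) ≡ (if b then 𝟙 c else 0ℤ)
𝟙-∧ true  c = refl
𝟙-∧ false c = refl

𝟙-∧-* : ∀ b c → 𝟙 (b ∧ c) ≡ 𝟙 c ℤ.* 𝟙 b
𝟙-∧-* b true  rewrite ∧-identityʳ b = sym (ℤP.*-identityˡ _)
𝟙-∧-* b false rewrite ∧-zeroʳ b = refl

∑-δ : ∀ n (w : Fin n) (h : Fin n → ℤ) → ∑[ x < n ] (if x ≟ᵇ w then h x else 0ℤ) ≡ h w
∑-δ (suc n) w h =
  trans (sum-remove {i = w} (λ x → if x ≟ᵇ w then h x else 0ℤ))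
        (trans (cong₂ ℤ._+_ at-w (trans (∑-cong n off-w) (∑-zero n))) (ℤP.+-identityʳ _))
  where
  at-w : (if w ≟ᵇ w then h w else 0ℤ) ≡ h w
  at-w with w FinP.≟ w
  ... | yes _  = refl
  ... | no w≢w = ⊥-elim (w≢w refl)
  off-w : ∀ i → (if punchIn w i ≟ᵇ w then h (punchIn w i) else 0ℤ) ≡ 0ℤ
  off-w i with punchIn w i FinP.≟ w
  ... | yes e = ⊥-elim (FinP.punchInᵢ≢i w i e)
  ... | no _  = refl

<ᵇ⇒< : ∀ {m n} → (m <ᵇ n) ≡ true → m ℕ.< n
<ᵇ⇒< {m} {n} e = ℕP.<ᵇ⇒< m n (Equivalence.from T-≡ e)

<⇒<ᵇ : ∀ {m n} → m ℕ.< n → (m <ᵇ n) ≡ true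
<⇒<ᵇ m<n = Equivalence.to T-≡ (ℕP.<⇒<ᵇ m<n)

≤⇒<ᵇ-false : ∀ {m n} → m ℕ.≤ n → (n <ᵇ m) ≡ false
≤⇒<ᵇ-false {zero}  {n}     _           = refl
≤⇒<ᵇ-false {suc m} {suc n} (ℕ.s≤s m≤n) = ≤⇒<ᵇ-false m≤n

_≗ᵇ_ : ∀ {n m} → (Fin n → Fin m) → (Fin n → Fin m) → Bool
_≗ᵇ_ {zero}  f g = true
_≗ᵇ_ {suc n} f g = (f Fin.zero ≟ᵇ g Fin.zero) ∧ ((λ i → f (Fin.suc i)) ≗ᵇ (λ i → g (Fin.suc i)))

≗ᵇ⇒≗ : ∀ {n m} (f g : Fin n → Fin m) → (f ≗ᵇ g) ≡ true → f ≗ g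
≗ᵇ⇒≗ {suc n} f g e Fin.zero    = ≟ᵇ⇒≡ (proj₁ (∧-true⁻ e))
≗ᵇ⇒≗ {suc n} f g e (Fin.suc i) = ≗ᵇ⇒≗ _ _ (proj₂ (∧-true⁻ e)) i

≗⇒≗ᵇ : ∀ {n m} (f g : Fin n → Fin m) → f ≗ g → (f ≗ᵇ g) ≡ true
≗⇒≗ᵇ {zero}  f g f≗g = refl
≗⇒≗ᵇ {suc n} f g f≗g = ∧-true (≡⇒≟ᵇ (f≗g Fin.zero)) (≗⇒≗ᵇ _ _ (λ i → f≗g (Fin.suc i)))

≗ᵇ-cong : ∀ {n m k l} (f g : Fin n → Fin m) (f′ g′ : Fin k → Fin l) →
          (f ≗ g → f′ ≗ g′) → (f′ ≗ g′ → f ≗ g) → (f ≗ᵇ g) ≡ (f′ ≗ᵇ g′)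
≗ᵇ-cong f g f′ g′ to from =
  bool-ext (λ e → ≗⇒≗ᵇ f′ g′ (to (≗ᵇ⇒≗ f g e))) (λ e → ≗⇒≗ᵇ f g (from (≗ᵇ⇒≗ f′ g′ e)))

≗ᵇ-sym : ∀ {n m} (f g : Fin n → Fin m) → (f ≗ᵇ g) ≡ (g ≗ᵇ f)
≗ᵇ-sym f g = ≗ᵇ-cong f g g f (λ e i → sym (e i)) (λ e i → sym (e i))

allᵇ-++ : ∀ {X : Set} (p : X → Bool) xs ys → allᵇ p (xs ++ ys) ≡ (allᵇ p xs ∧ allᵇ p ys)
allᵇ-++ p []       ys = refl
allᵇ-++ p (x ∷ xs) ys rewrite allᵇ-++ p xs ys = sym (∧-assoc (p x) _ _)

allᵇ-tabulate⁻ : ∀ {X : Set} n (q : X → Bool) (g : Fin n → X) → allᵇ q (tabulate g) ≡ true → ∀ i → q (g i) ≡ true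
allᵇ-tabulate⁻ (suc n) q g e Fin.zero    = proj₁ (∧-true⁻ e)
allᵇ-tabulate⁻ (suc n) q g e (Fin.suc i) = allᵇ-tabulate⁻ n q (λ j → g (Fin.suc j)) (proj₂ (∧-true⁻ e)) i

allᵇ-tabulate⁺ : ∀ {X : Set} n (q : X → Bool) (g : Fin n → X) → (∀ i → q (g i) ≡ true) → allᵇ q (tabulate g) ≡ true
allᵇ-tabulate⁺ zero    q g e = refl
allᵇ-tabulate⁺ (suc n) q g e = ∧-true (e Fin.zero) (allᵇ-tabulate⁺ n q (λ j → g (Fin.suc j)) (λ i → e (Fin.suc i)))

allᵇ-pairs : ∀ n (p : Fin n × Fin n → Bool) → allᵇ p (pairs n) ≡ allᵇ (λ u → allᵇ (λ w → p (u , w)) (allFin n)) (allFin n)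
allᵇ-pairs n p = trans (concat-lemma (allFin n)) (cong-allᵇ (allFin n))
  where
  concat-lemma : ∀ us → allᵇ p (concatMap (λ u → map (λ w → (u , w)) (allFin n)) us)
                      ≡ allᵇ (λ u → allᵇ p (map (λ w → (u , w)) (allFin n))) us
  concat-lemma []       = refl
  concat-lemma (u ∷ us) = trans (allᵇ-++ p (map (λ w → (u , w)) (allFin n)) _) (cong (_ ∧_) (concat-lemma us))
  map-lemma : ∀ u ws → allᵇ p (map (λ w → (u , w)) ws) ≡ allᵇ (λ w → p (u , w)) ws
  map-lemma u []       = refl
  map-lemma u (w ∷ ws) = cong (p (u , w) ∧_) (map-lemma u ws)
  cong-allᵇ : ∀ us → allᵇ (λ u → allᵇ p (map (λ w → (u , w)) (allFin n))) us
                   ≡ allᵇ (λ u → allᵇ (λ w → p (u , w)) (allFin n)) us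
  cong-allᵇ []       = refl
  cong-allᵇ (u ∷ us) = cong₂ _∧_ (map-lemma u (allFin n)) (cong-allᵇ us)

allᵇ-pairs⁻ : ∀ n (p : Fin n × Fin n → Bool) → allᵇ p (pairs n) ≡ true → ∀ u w → p (u , w) ≡ true
allᵇ-pairs⁻ n p e u w =
  allᵇ-tabulate⁻ n _ (λ i → i) (allᵇ-tabulate⁻ n _ (λ i → i) (trans (sym (allᵇ-pairs n p)) e) u) w

allᵇ-pairs⁺ : ∀ n (p : Fin n × Fin n → Bool) → (∀ u w → p (u , w) ≡ true) → allᵇ p (pairs n) ≡ true
allᵇ-pairs⁺ n p e =
  trans (allᵇ-pairs n p) (allᵇ-tabulate⁺ n _ (λ i → i) (λ u → allᵇ-tabulate⁺ n _ (λ i → i) (e u)))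

isInjᵇ-sound : ∀ {n} (σ : Fin n → Fin n) → isInjᵇ σ ≡ true → Injective _≡_ _≡_ σ
isInjᵇ-sound {n} σ e {u} {w} σu≡σw = ≟ᵇ⇒≡ (test (allᵇ-pairs⁻ n _ e u w))
  where
  test : (not (σ u ≟ᵇ σ w) ∨ (u ≟ᵇ w)) ≡ true → (u ≟ᵇ w) ≡ true
  test h rewrite σu≡σw | ≡⇒≟ᵇ {x = σ w} refl = h

isInjᵇ-complete : ∀ {n} (σ : Fin n → Fin n) → Injective _≡_ _≡_ σ → isInjᵇ σ ≡ true
isInjᵇ-complete {n} σ inj = allᵇ-pairs⁺ n _ test
  where
  test : ∀ u w → (not (σ u ≟ᵇ σ w) ∨ (u ≟ᵇ w)) ≡ true
  test u w with u FinP.≟ w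
  ... | yes refl = ∨-zeroʳ _
  ... | no u≢w rewrite ≢⇒≟ᵇ {x = σ u} {σ w} (λ e → u≢w (inj e)) = refl

injective⇒surjective : ∀ {n} (σ : Fin n → Fin n) → Injective _≡_ _≡_ σ → ∀ k → ∃ λ x → σ x ≡ k
injective⇒surjective {n} σ inj k with FinP.any? (λ x → σ x FinP.≟ k)
... | yes hit = hit
injective⇒surjective {suc n} σ inj k | no miss =
  let (i , j , i<j , eq) = FinP.pigeonhole (ℕP.n<1+n n) avoid-k
  in ⊥-elim (FinP.<-irrefl (inj (FinP.punchOut-injective (λ e → miss (i , sym e)) (λ e → miss (j , sym e)) eq)) i<j)
  where
  avoid-k : Fin (suc n) → Fin n
  avoid-k x = punchOut {i = k} {j = σ x} (λ e → miss (x , sym e))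

module Inverse {n} (σ : Fin n → Fin n) (inj : Injective _≡_ _≡_ σ) where

  σ⁻¹ : Fin n → Fin n
  σ⁻¹ k = proj₁ (injective⇒surjective σ inj k)

  σ∘σ⁻¹ : ∀ k → σ (σ⁻¹ k) ≡ k
  σ∘σ⁻¹ k = proj₂ (injective⇒surjective σ inj k)

  σ⁻¹∘σ : ∀ x → σ⁻¹ (σ x) ≡ x
  σ⁻¹∘σ x = inj (σ∘σ⁻¹ (σ x))

  σ⁻¹-injective : Injective _≡_ _≡_ σ⁻¹
  σ⁻¹-injective {k} {l} e = trans (sym (σ∘σ⁻¹ k)) (trans (cong σ e) (σ∘σ⁻¹ l))

∑-reindex : ∀ n (σ : Fin n → Fin n) → Injective _≡_ _≡_ σ → ∀ h → ∑[ x < n ] h (σ x) ≡ ∑[ x < n ] h x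
∑-reindex n σ inj h = sym (∑-permute h (Perm.permutation σ σ⁻¹ σ∘σ⁻¹ σ⁻¹∘σ))
  where open Inverse σ inj

-- L lists the elements satisfying P, each once up to _≈ᵇ_; sums over L only see such elements.
module Enumeration {X : Set} (_≈ᵇ_ : X → X → Bool) (≈ᵇ-sym : ∀ x y → (x ≈ᵇ y) ≡ (y ≈ᵇ x)) (P : X → Set) where

  Enumerates : List X → Set
  Enumerates L = (∀ (F G : X → ℤ) → (∀ x → P x → F x ≡ G x) → listSum L F ≡ listSum L G)
               × (∀ x → P x → ∑[ y ∈ L ] 𝟙 (x ≈ᵇ y) ≡ 1ℤ)

  -- Both sums equal the double sum of 𝟙 (x ≈ᵇ y) F y over L₁ × L₂.
  ∑ˡ-enumeration : ∀ {L₁ L₂} → Enumerates L₁ → Enumerates L₂ →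
                   (F : X → ℤ) → (∀ x y → (x ≈ᵇ y) ≡ true → F x ≡ F y) → listSum L₁ F ≡ listSum L₂ F
  ∑ˡ-enumeration {L₁} {L₂} (restrict₁ , unique₁) (restrict₂ , unique₂) F F-resp = begin
      listSum L₁ F
    ≡⟨ restrict₁ _ _ (λ x Px → sym (weigh x (F x) (unique₂ x Px))) ⟩
      ∑[ x ∈ L₁ ] ∑[ y ∈ L₂ ] (𝟙 (x ≈ᵇ y) ℤ.* F x)
    ≡⟨ ∑ˡ-cong L₁ (λ x → ∑ˡ-cong L₂ (λ y → move x y)) ⟩
      ∑[ x ∈ L₁ ] ∑[ y ∈ L₂ ] (𝟙 (x ≈ᵇ y) ℤ.* F y)
    ≡⟨ ∑ˡ-comm L₁ L₂ _ ⟩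
      ∑[ y ∈ L₂ ] ∑[ x ∈ L₁ ] (𝟙 (x ≈ᵇ y) ℤ.* F y)
    ≡⟨ restrict₂ _ _ (λ y Py → weigh′ y (trans (∑ˡ-cong L₁ (λ x → cong 𝟙 (≈ᵇ-sym x y))) (unique₁ y Py))) ⟩
      listSum L₂ F
    ∎
    where
    open ≡-Reasoning
    weigh : ∀ x c → ∑[ y ∈ L₂ ] 𝟙 (x ≈ᵇ y) ≡ 1ℤ → ∑[ y ∈ L₂ ] (𝟙 (x ≈ᵇ y) ℤ.* c) ≡ c
    weigh x c one = trans (∑ˡ-cong L₂ (λ y → ℤP.*-comm (𝟙 (x ≈ᵇ y)) c))
                          (trans (*-distribˡ-∑ˡ L₂ c _) (trans (cong (c ℤ.*_) one) (ℤP.*-identityʳ c)))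
    weigh′ : ∀ y → ∑[ x ∈ L₁ ] 𝟙 (x ≈ᵇ y) ≡ 1ℤ → ∑[ x ∈ L₁ ] (𝟙 (x ≈ᵇ y) ℤ.* F y) ≡ F y
    weigh′ y one = trans (∑ˡ-cong L₁ (λ x → ℤP.*-comm (𝟙 (x ≈ᵇ y)) (F y)))
                         (trans (*-distribˡ-∑ˡ L₁ (F y) _) (trans (cong (F y ℤ.*_) one) (ℤP.*-identityʳ (F y))))
    move : ∀ x y → 𝟙 (x ≈ᵇ y) ℤ.* F x ≡ 𝟙 (x ≈ᵇ y) ℤ.* F y
    move x y with x ≈ᵇ y in x≈y
    ... | true  = cong (1ℤ ℤ.*_) (F-resp x y x≈y)
    ... | false = refl

EnumeratesInjections : ∀ n → List (Fin n → Fin n) → Set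
EnumeratesInjections n = Enumeration.Enumerates _≗ᵇ_ ≗ᵇ-sym (Injective _≡_ _≡_)

-- Sums over bijections

allFuns-unique : ∀ n m (g : Fin n → Fin m) → ∑[ h ∈ allFuns n m ] 𝟙 (g ≗ᵇ h) ≡ 1ℤ
allFuns-unique zero    m g = refl
allFuns-unique (suc n) m g = begin
    ∑[ h ∈ allFuns (suc n) m ] 𝟙 (g ≗ᵇ h)
  ≡⟨ ∑ˡ-concatMap _ (allFin m) _ ⟩
    ∑[ a ∈ allFin m ] listSum (map _ (allFuns n m)) (λ h → 𝟙 (g ≗ᵇ h))
  ≡⟨ ∑ˡ-cong (allFin m) (λ a → trans (∑ˡ-map _ (allFuns n m) _) (∑ˡ-cong (allFuns n m) (λ h → 𝟙-∧ (g Fin.zero ≟ᵇ a) _))) ⟩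
    ∑[ a ∈ allFin m ] ∑[ h ∈ allFuns n m ] (if g Fin.zero ≟ᵇ a then 𝟙 (g′ ≗ᵇ h) else 0ℤ)
  ≡⟨ ∑ˡ-cong (allFin m) tail-sum ⟩
    ∑[ a ∈ allFin m ] (if a ≟ᵇ g Fin.zero then 1ℤ else 0ℤ)
  ≡⟨ trans (∑ˡ-allFin m _) (∑-δ m (g Fin.zero) (λ _ → 1ℤ)) ⟩
    1ℤ
  ∎
  where
  open ≡-Reasoning
  g′ = λ i → g (Fin.suc i)
  tail-sum : ∀ a → ∑[ h ∈ allFuns n m ] (if g Fin.zero ≟ᵇ a then 𝟙 (g′ ≗ᵇ h) else 0ℤ)
                 ≡ (if a ≟ᵇ g Fin.zero then 1ℤ else 0ℤ)
  tail-sum a rewrite ≟ᵇ-sym (g Fin.zero) a with a ≟ᵇ g Fin.zero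
  ... | true  = allFuns-unique n m g′
  ... | false = ∑ˡ-zero (allFuns n m)

∑-bijections : ∀ n F → listSum (bijections n) F ≡ ∑[ h ∈ allFuns n n ] (if isInjᵇ h then F h else 0ℤ)
∑-bijections n F = ∑ˡ-filter isInjᵇ (allFuns n n) F

bijections-enumerate : ∀ n → EnumeratesInjections n (bijections n)
bijections-enumerate n = restrict , unique
  where
  restrict : ∀ F G → (∀ σ → Injective _≡_ _≡_ σ → F σ ≡ G σ) → listSum (bijections n) F ≡ listSum (bijections n) G
  restrict F G F≡G = trans (∑-bijections n F) (trans (∑ˡ-cong (allFuns n n) on-inj) (sym (∑-bijections n G)))
    where
    on-inj : ∀ h → (if isInjᵇ h then F h else 0ℤ) ≡ (if isInjᵇ h then G h else 0ℤ)
    on-inj h with isInjᵇ h in inj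
    ... | true  = F≡G h (isInjᵇ-sound h inj)
    ... | false = refl
  unique : ∀ σ → Injective _≡_ _≡_ σ → ∑[ h ∈ bijections n ] 𝟙 (σ ≗ᵇ h) ≡ 1ℤ
  unique σ inj = trans (∑-bijections n _) (trans (∑ˡ-cong (allFuns n n) drop-test) (allFuns-unique n n σ))
    where
    drop-test : ∀ h → (if isInjᵇ h then 𝟙 (σ ≗ᵇ h) else 0ℤ) ≡ 𝟙 (σ ≗ᵇ h)
    drop-test h with σ ≗ᵇ h in σ≗h
    ... | true rewrite isInjᵇ-complete h (λ e → inj (trans (≗ᵇ⇒≗ σ h σ≗h _) (trans e (sym (≗ᵇ⇒≗ σ h σ≗h _))))) = refl
    ... | false with isInjᵇ h
    ... | true  = refl
    ... | false = refl

∑-bij-cong : ∀ n (F G : (Fin n → Fin n) → ℤ) → (∀ σ → Injective _≡_ _≡_ σ → F σ ≡ G σ) →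
             listSum (bijections n) F ≡ listSum (bijections n) G
∑-bij-cong n = proj₁ (bijections-enumerate n)

RespectsValues : ∀ {n} → ((Fin n → Fin n) → ℤ) → Set
RespectsValues {n} F = ∀ (σ τ : Fin n → Fin n) → σ ≗ τ → F σ ≡ F τ

∑-bij-enumeration : ∀ n L → EnumeratesInjections n L → ∀ F → RespectsValues F →
                    listSum (bijections n) F ≡ listSum L F
∑-bij-enumeration n L enum F F-resp =
  Enumeration.∑ˡ-enumeration _≗ᵇ_ ≗ᵇ-sym (Injective _≡_ _≡_) {L₁ = bijections n} {L₂ = L}
    (bijections-enumerate n) enum F (λ σ τ e → F-resp σ τ (≗ᵇ⇒≗ σ τ e))

∑-𝟙-≟ᵇ : ∀ n (w : Fin n) → ∑[ x < n ] 𝟙 (x ≟ᵇ w) ≡ 1ℤ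
∑-𝟙-≟ᵇ n w = trans (∑-cong n (λ x → as-if (x ≟ᵇ w))) (∑-δ n w (λ _ → 1ℤ))
  where
  as-if : ∀ b → 𝟙 b ≡ (if b then 1ℤ else 0ℤ)
  as-if true  = refl
  as-if false = refl

map-enumerates : ∀ n (φ ψ : (Fin n → Fin n) → (Fin n → Fin n)) →
  (∀ τ → Injective _≡_ _≡_ τ → Injective _≡_ _≡_ (φ τ)) →
  (∀ σ → Injective _≡_ _≡_ σ → Injective _≡_ _≡_ (ψ σ)) →
  (∀ σ τ → σ ≗ φ τ → ψ σ ≗ τ) → (∀ σ τ → ψ σ ≗ τ → σ ≗ φ τ) →
  EnumeratesInjections n (map φ (bijections n))
map-enumerates n φ ψ φ-inj ψ-inj to from = restrict , unique
  where
  restrict : ∀ F G → (∀ σ → Injective _≡_ _≡_ σ → F σ ≡ G σ) → listSum (map φ (bijections n)) F ≡ listSum (map φ (bijections n)) G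
  restrict F G F≡G =
    trans (∑ˡ-map φ (bijections n) F)
          (trans (∑-bij-cong n (λ τ → F (φ τ)) (λ τ → G (φ τ)) (λ τ inj → F≡G (φ τ) (φ-inj τ inj)))
                 (sym (∑ˡ-map φ (bijections n) G)))
  unique : ∀ σ → Injective _≡_ _≡_ σ → ∑[ h ∈ map φ (bijections n) ] 𝟙 (σ ≗ᵇ h) ≡ 1ℤ
  unique σ inj =
    trans (∑ˡ-map φ (bijections n) _)
          (trans (∑ˡ-cong (bijections n) (λ τ → cong 𝟙 (≗ᵇ-cong σ (φ τ) (ψ σ) τ (to σ τ) (from σ τ))))
                 (proj₂ (bijections-enumerate n) (ψ σ) (ψ-inj σ inj)))

∑-bij-∘ˡ : ∀ n (β : Fin n → Fin n) → Injective _≡_ _≡_ β → ∀ F → RespectsValues F →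
           listSum (bijections n) F ≡ ∑[ τ ∈ bijections n ] F (λ x → β (τ x))
∑-bij-∘ˡ n β β-inj F F-resp =
  trans (∑-bij-enumeration n (map (λ τ x → β (τ x)) (bijections n)) enum F F-resp) (∑ˡ-map (λ τ x → β (τ x)) (bijections n) F)
  where
  open Inverse β β-inj renaming (σ⁻¹ to β⁻¹; σ∘σ⁻¹ to β∘β⁻¹; σ⁻¹∘σ to β⁻¹∘β; σ⁻¹-injective to β⁻¹-injective)
  enum : EnumeratesInjections n (map (λ τ x → β (τ x)) (bijections n))
  enum = map-enumerates n (λ τ x → β (τ x)) (λ σ x → β⁻¹ (σ x))
           (λ τ τ-inj e → τ-inj (β-inj e)) (λ σ σ-inj e → σ-inj (β⁻¹-injective e))
           (λ σ τ e i → trans (cong β⁻¹ (e i)) (β⁻¹∘β (τ i)))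
           (λ σ τ e i → trans (sym (β∘β⁻¹ (σ i))) (cong β (e i)))

∑-bij-∘ʳ : ∀ n (α : Fin n → Fin n) → Injective _≡_ _≡_ α → ∀ F → RespectsValues F →
           listSum (bijections n) F ≡ ∑[ τ ∈ bijections n ] F (λ x → τ (α x))
∑-bij-∘ʳ n α α-inj F F-resp =
  trans (∑-bij-enumeration n (map (λ τ x → τ (α x)) (bijections n)) enum F F-resp) (∑ˡ-map (λ τ x → τ (α x)) (bijections n) F)
  where
  open Inverse α α-inj renaming (σ⁻¹ to α⁻¹; σ∘σ⁻¹ to α∘α⁻¹; σ⁻¹∘σ to α⁻¹∘α; σ⁻¹-injective to α⁻¹-injective)
  enum : EnumeratesInjections n (map (λ τ x → τ (α x)) (bijections n))
  enum = map-enumerates n (λ τ x → τ (α x)) (λ σ x → σ (α⁻¹ x))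
           (λ τ τ-inj e → α-inj (τ-inj e)) (λ σ σ-inj e → α⁻¹-injective (σ-inj e))
           (λ σ τ e i → trans (e (α⁻¹ i)) (cong τ (α∘α⁻¹ i)))
           (λ σ τ e i → trans (cong σ (sym (α⁻¹∘α i))) (e (α i)))

extendAt : ∀ {n} → Fin (suc n) → Fin (suc n) → (Fin n → Fin n) → Fin (suc n) → Fin (suc n)
extendAt p w τ x with p FinP.≟ x
... | yes _   = w
... | no p≢x = punchIn w (τ (punchOut p≢x))

extendAt-at : ∀ {n} p w (τ : Fin n → Fin n) → extendAt p w τ p ≡ w
extendAt-at p w τ with p FinP.≟ p
... | yes _   = refl
... | no p≢p = ⊥-elim (p≢p refl)

extendAt-punchIn : ∀ {n} p w (τ : Fin n → Fin n) i → extendAt p w τ (punchIn p i) ≡ punchIn w (τ i)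
extendAt-punchIn p w τ i with p FinP.≟ punchIn p i
... | yes e   = ⊥-elim (FinP.punchInᵢ≢i p i (sym e))
... | no p≢pi = cong (λ z → punchIn w (τ z)) (trans (FinP.punchOut-cong p refl) (FinP.punchOut-punchIn p))

extendAt-injective : ∀ {n} p w (τ : Fin n → Fin n) → Injective _≡_ _≡_ τ → Injective _≡_ _≡_ (extendAt p w τ)
extendAt-injective p w τ inj {x} {y} eq with p FinP.≟ x | p FinP.≟ y
... | yes p≡x | yes p≡y = trans (sym p≡x) p≡y
... | yes _   | no _    = ⊥-elim (FinP.punchInᵢ≢i w _ (sym eq))
... | no _    | yes _   = ⊥-elim (FinP.punchInᵢ≢i w _ eq)
... | no p≢x  | no p≢y  = FinP.punchOut-injective p≢x p≢y (inj (FinP.punchIn-injective w _ _ eq))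

∑-extendAt-𝟙 : ∀ {n} (σ : Fin (suc n) → Fin (suc n)) → Injective _≡_ _≡_ σ → ∀ p w →
  ∑[ τ ∈ bijections n ] 𝟙 (σ ≗ᵇ extendAt p w τ) ≡ 𝟙 (σ p ≟ᵇ w)
∑-extendAt-𝟙 {n} σ inj p w with σ p FinP.≟ w
... | yes refl = trans (∑ˡ-cong (bijections n) (λ τ → cong 𝟙 (same τ))) (proj₂ (bijections-enumerate n) rest rest-injective)
  where
  avoids : ∀ i → σ p ≢ σ (punchIn p i)
  avoids i e = FinP.punchInᵢ≢i p i (sym (inj e))
  rest : Fin n → Fin n
  rest i = punchOut (avoids i)
  rest-injective : Injective _≡_ _≡_ rest
  rest-injective e = FinP.punchIn-injective p _ _ (inj (FinP.punchOut-injective (avoids _) (avoids _) e))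
  same : ∀ τ → (σ ≗ᵇ extendAt p (σ p) τ) ≡ (rest ≗ᵇ τ)
  same τ = ≗ᵇ-cong σ (extendAt p (σ p) τ) rest τ to from
    where
    to : σ ≗ extendAt p (σ p) τ → rest ≗ τ
    to h i = trans (FinP.punchOut-cong (σ p) (trans (h (punchIn p i)) (extendAt-punchIn p (σ p) τ i)))
                   (FinP.punchOut-punchIn (σ p))
    from : rest ≗ τ → σ ≗ extendAt p (σ p) τ
    from h x with p FinP.≟ x
    ... | yes refl = refl
    ... | no p≢x   = trans (cong σ (sym (FinP.punchIn-punchOut p≢x)))
                           (trans (sym (FinP.punchIn-punchOut (avoids (punchOut p≢x)))) (cong (punchIn (σ p)) (h (punchOut p≢x))))
... | no σp≢w = trans (∑ˡ-cong (bijections n) (λ τ → cong 𝟙 (never τ))) (∑ˡ-zero (bijections n))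
  where
  never : ∀ τ → (σ ≗ᵇ extendAt p w τ) ≡ false
  never τ with σ ≗ᵇ extendAt p w τ in e
  ... | true  = ⊥-elim (σp≢w (trans (≗ᵇ⇒≗ σ (extendAt p w τ) e p) (extendAt-at p w τ)))
  ... | false = refl

extensions : ∀ n → (Fin (suc n) → Fin (suc n) × Fin (suc n)) → List (Fin (suc n) → Fin (suc n))
extensions n c = concatMap (λ k → map (extendAt (proj₁ (c k)) (proj₂ (c k))) (bijections n)) (allFin (suc n))

∑-extensions : ∀ n c F →
  listSum (extensions n c) F ≡ ∑[ k < suc n ] ∑[ τ ∈ bijections n ] F (extendAt (proj₁ (c k)) (proj₂ (c k)) τ)
∑-extensions n c F =
  trans (∑ˡ-concatMap (λ k → map (extendAt (proj₁ (c k)) (proj₂ (c k))) (bijections n)) (allFin (suc n)) F)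
        (trans (∑ˡ-cong (allFin (suc n)) (λ k → ∑ˡ-map (extendAt (proj₁ (c k)) (proj₂ (c k))) (bijections n) F))
               (∑ˡ-allFin (suc n) (λ k → ∑[ τ ∈ bijections n ] F (extendAt (proj₁ (c k)) (proj₂ (c k)) τ))))

extensions-enumerate : ∀ n c →
  (∀ σ → Injective _≡_ _≡_ σ → ∑[ k < suc n ] 𝟙 (σ (proj₁ (c k)) ≟ᵇ proj₂ (c k)) ≡ 1ℤ) →
  EnumeratesInjections (suc n) (extensions n c)
extensions-enumerate n c one-choice = restrict , unique
  where
  restrict : ∀ F G → (∀ σ → Injective _≡_ _≡_ σ → F σ ≡ G σ) → listSum (extensions n c) F ≡ listSum (extensions n c) G
  restrict F G F≡G =
    trans (∑-extensions n c F)
          (trans (∑-cong (suc n) (λ k → ∑-bij-cong n (λ τ → F (extendAt (proj₁ (c k)) (proj₂ (c k)) τ)) (λ τ → G (extendAt (proj₁ (c k)) (proj₂ (c k)) τ))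
                                                (λ τ inj → F≡G _ (extendAt-injective (proj₁ (c k)) (proj₂ (c k)) τ inj))))
                 (sym (∑-extensions n c G)))
  unique : ∀ σ → Injective _≡_ _≡_ σ → ∑[ h ∈ extensions n c ] 𝟙 (σ ≗ᵇ h) ≡ 1ℤ
  unique σ inj =
    trans (∑-extensions n c _)
          (trans (∑-cong (suc n) (λ k → ∑-extendAt-𝟙 σ inj (proj₁ (c k)) (proj₂ (c k)))) (one-choice σ inj))

∑-bij-by-value : ∀ n (p : Fin (suc n)) F → RespectsValues F →
  listSum (bijections (suc n)) F ≡ ∑[ w < suc n ] ∑[ τ ∈ bijections n ] F (extendAt p w τ)
∑-bij-by-value n p F F-resp =
  trans (∑-bij-enumeration (suc n) (extensions n (λ w → p , w)) (extensions-enumerate n (λ w → p , w) one-value) F F-resp)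
        (∑-extensions n (λ w → p , w) F)
  where
  one-value : ∀ σ → Injective _≡_ _≡_ σ → ∑[ w < suc n ] 𝟙 (σ p ≟ᵇ w) ≡ 1ℤ
  one-value σ _ = trans (∑-cong (suc n) (λ w → cong 𝟙 (≟ᵇ-sym (σ p) w))) (∑-𝟙-≟ᵇ (suc n) (σ p))

∑-bij-by-preimage : ∀ n (w : Fin (suc n)) F → RespectsValues F →
  listSum (bijections (suc n)) F ≡ ∑[ p < suc n ] ∑[ τ ∈ bijections n ] F (extendAt p w τ)
∑-bij-by-preimage n w F F-resp =
  trans (∑-bij-enumeration (suc n) (extensions n (λ p → p , w)) (extensions-enumerate n (λ p → p , w) one-preimage) F F-resp)
        (∑-extensions n (λ p → p , w) F)
  where
  one-preimage : ∀ σ → Injective _≡_ _≡_ σ → ∑[ p < suc n ] 𝟙 (σ p ≟ᵇ w) ≡ 1ℤ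
  one-preimage σ inj =
    trans (∑-cong (suc n) (λ p → cong 𝟙 (≟ᵇ-cong (λ e → trans (sym (σ⁻¹∘σ p)) (cong σ⁻¹ e)) (λ e → trans (cong σ e) (σ∘σ⁻¹ w)))))
          (∑-𝟙-≟ᵇ (suc n) (σ⁻¹ w))
    where open Inverse σ inj

∑-bij-const : ∀ n c → ∑[ σ ∈ bijections n ] c ≡ + (n !) ℤ.* c
∑-bij-const zero    c = trans (ℤP.+-identityʳ c) (sym (ℤP.*-identityˡ c))
∑-bij-const (suc n) c = begin
    ∑[ σ ∈ bijections (suc n) ] c
  ≡⟨ ∑-bij-by-value n Fin.zero (λ _ → c) (λ _ _ _ → refl) ⟩
    ∑[ w < suc n ] ∑[ τ ∈ bijections n ] c
  ≡⟨ ∑-cong (suc n) (λ w → ∑-bij-const n c) ⟩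
    ∑[ w < suc n ] (+ (n !) ℤ.* c)
  ≡⟨ ∑-const (suc n) (+ (n !) ℤ.* c) ⟩
    + suc n ℤ.* (+ (n !) ℤ.* c)
  ≡⟨ sym (ℤP.*-assoc (+ suc n) (+ (n !)) c) ⟩
    + suc n ℤ.* + (n !) ℤ.* c
  ≡⟨ cong (ℤ._* c) (sym (ℤP.pos-* (suc n) (n !))) ⟩
    + (suc n !) ℤ.* c
  ∎
  where open ≡-Reasoning

-- Signed descent sums

sgn : ℕ → ℤ
sgn k = -1ℤ ℤ.^ k

sgn-+ : ∀ a b → sgn (a ℕ.+ b) ≡ sgn a ℤ.* sgn b
sgn-+ a b = ℤP.^-distribˡ-+-* -1ℤ a b

∣sgn∣ : ∀ k → ∣ sgn k ∣ ≡ 1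
∣sgn∣ zero    = refl
∣sgn∣ (suc k) = trans (ℤP.abs-* -1ℤ (sgn k)) (trans (ℕP.*-identityˡ _) (∣sgn∣ k))

∣sgn*∣ : ∀ k x → ∣ sgn k ℤ.* x ∣ ≡ ∣ x ∣
∣sgn*∣ k x = trans (ℤP.abs-* (sgn k) x) (trans (cong (ℕ._* ∣ x ∣) (∣sgn∣ k)) (ℕP.*-identityˡ _))

-- A₋₁ G is A_D(-1) for the orientation D = orient G of Defs, so that ν G = ∣ A₋₁ G ∣ holds by definition.
A₋₁ : ∀ {n} → Graph n → ℤ
A₋₁ {n} G = ∑[ σ ∈ bijections n ] sgn (des (orient G) σ)

count-cong : ∀ {X : Set} {p q : X → Bool} → (∀ x → p x ≡ q x) → ∀ xs → count p xs ≡ count q xs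
count-cong p≗q []       = refl
count-cong p≗q (x ∷ xs) rewrite p≗q x = cong (_ ℕ.+_) (count-cong p≗q xs)

desAlong : ∀ {n m} → Digraph n → (Fin n → Fin m) → ℕ
desAlong {n} D h = count (λ x → D (proj₁ x) (proj₂ x) ∧ (toℕ (h (proj₂ x)) <ᵇ toℕ (h (proj₁ x)))) (pairs n)

des≡desAlong : ∀ {n} (D : Digraph n) σ → des D σ ≡ desAlong D σ
des≡desAlong {n} D σ = count-cong (λ { (u , w) → refl }) (pairs n)

desAlong-ℤ : ∀ {n m} (D : Digraph n) (h : Fin n → Fin m) →
  + desAlong D h ≡ ∑[ u < n ] ∑[ w < n ] 𝟙 (D u w ∧ (toℕ (h w) <ᵇ toℕ (h u)))
desAlong-ℤ {n} D h = trans (count≡∑ˡ _ (pairs n)) (∑ˡ-pairs n _)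

des-ℤ : ∀ {n} (D : Digraph n) σ → + des D σ ≡ ∑[ u < n ] ∑[ w < n ] 𝟙 (D u w ∧ (toℕ (σ w) <ᵇ toℕ (σ u)))
des-ℤ D σ = trans (cong +_ (des≡desAlong D σ)) (desAlong-ℤ D σ)

desAlong-order : ∀ {n m m′} (D : Digraph n) (h : Fin n → Fin m) (h′ : Fin n → Fin m′) →
  (∀ a b → (toℕ (h a) <ᵇ toℕ (h b)) ≡ (toℕ (h′ a) <ᵇ toℕ (h′ b))) → desAlong D h ≡ desAlong D h′
desAlong-order {n} D h h′ same = count-cong (λ x → cong (D (proj₁ x) (proj₂ x) ∧_) (same (proj₂ x) (proj₁ x))) (pairs n)

des-≗ : ∀ {n} (D : Digraph n) (σ τ : Fin n → Fin n) → σ ≗ τ → des D σ ≡ des D τ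
des-≗ {n} D σ τ σ≗τ = count-cong (λ { (u , w) → cong₂ (λ a b → D u w ∧ (toℕ a <ᵇ toℕ b)) (σ≗τ w) (σ≗τ u) }) (pairs n)

sgn-des-respects : ∀ {n} (D : Digraph n) → RespectsValues (λ σ → sgn (des D σ))
sgn-des-respects D σ τ σ≗τ = cong sgn (des-≗ D σ τ σ≗τ)

A₋₁-cong : ∀ {n} (G H : Graph n) → (∀ u w → adj G u w ≡ adj H u w) → A₋₁ G ≡ A₋₁ H
A₋₁-cong {n} G H same = ∑ˡ-cong (bijections n) (λ σ → cong sgn (count-cong (λ { (u , w) → cong (λ b → (b ∧ _) ∧ _) (same u w) }) (pairs n)))

A₋₁-cast : ∀ {n m} (eq : n ≡ m) (G : Graph n) (H : Graph m) →
  (∀ x y → adj H (Fin.cast eq x) (Fin.cast eq y) ≡ adj G x y) → A₋₁ G ≡ A₋₁ H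
A₋₁-cast refl G H same =
  A₋₁-cong G H (λ u w → trans (sym (same u w)) (cong₂ (adj H) (FinP.cast-is-id refl u) (FinP.cast-is-id refl w)))

punchIn-<ᵇ : ∀ {n} (p : Fin (suc n)) a b → (toℕ (punchIn p a) <ᵇ toℕ (punchIn p b)) ≡ (toℕ a <ᵇ toℕ b)
punchIn-<ᵇ Fin.zero    a           b           = refl
punchIn-<ᵇ (Fin.suc p) Fin.zero    Fin.zero    = refl
punchIn-<ᵇ (Fin.suc p) Fin.zero    (Fin.suc b) = refl
punchIn-<ᵇ (Fin.suc p) (Fin.suc a) Fin.zero    = refl
punchIn-<ᵇ (Fin.suc p) (Fin.suc a) (Fin.suc b) = punchIn-<ᵇ p a b

orient-deleteV : ∀ {n} (G : Graph (suc n)) p a b → orient G (punchIn p a) (punchIn p b) ≡ orient (deleteV G p) a b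
orient-deleteV G p a b = cong (adj G (punchIn p a) (punchIn p b) ∧_) (punchIn-<ᵇ p a b)

orient-irrefl : ∀ {n} (G : Graph n) p → orient G p p ≡ false
orient-irrefl G p rewrite irrefl G p = refl

lowerDegree : ∀ {n} → Graph n → Fin n → ℕ
lowerDegree {n} G p = count (λ u → orient G u p) (allFin n)

lowerDegree-ℤ : ∀ {n} (G : Graph n) p → + lowerDegree G p ≡ ∑[ u < n ] 𝟙 (orient G u p)
lowerDegree-ℤ {n} G p = trans (count≡∑ˡ _ (allFin n)) (∑ˡ-allFin n _)

∑-arcs-into : ∀ {n} (G : Graph (suc n)) p → ∑[ a < n ] 𝟙 (orient G (punchIn p a) p) ≡ + lowerDegree G p
∑-arcs-into {n} G p = begin
    ∑[ a < n ] 𝟙 (orient G (punchIn p a) p)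
  ≡⟨ sym (ℤP.+-identityˡ _) ⟩
    0ℤ ℤ.+ ∑[ a < n ] 𝟙 (orient G (punchIn p a) p)
  ≡⟨ cong (λ b → 𝟙 b ℤ.+ ∑[ a < n ] 𝟙 (orient G (punchIn p a) p)) (sym (orient-irrefl G p)) ⟩
    𝟙 (orient G p p) ℤ.+ ∑[ a < n ] 𝟙 (orient G (punchIn p a) p)
  ≡⟨ sym (sum-remove {i = p} (λ u → 𝟙 (orient G u p))) ⟩
    ∑[ u < suc n ] 𝟙 (orient G u p)
  ≡⟨ sym (lowerDegree-ℤ G p) ⟩
    + lowerDegree G p
  ∎
  where open ≡-Reasoning

-- Labelling p first makes every arc into p a descent, and none out of p.
des-extendAt-zero : ∀ {n} (G : Graph (suc n)) p (τ : Fin n → Fin n) →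
  des (orient G) (extendAt p Fin.zero τ) ≡ lowerDegree G p ℕ.+ des (orient (deleteV G p)) τ
des-extendAt-zero {n} G p τ = ℤP.+-injective (begin
    + des D σ
  ≡⟨ des-ℤ D σ ⟩
    ∑[ u < suc n ] ∑[ w < suc n ] f u w
  ≡⟨ sum-remove {i = p} (λ u → ∑[ w < suc n ] f u w) ⟩
    ∑[ w < suc n ] f p w ℤ.+ ∑[ a < n ] ∑[ w < suc n ] f (punchIn p a) w
  ≡⟨ cong₂ ℤ._+_ row-p (∑-cong n row-a) ⟩
    0ℤ ℤ.+ ∑[ a < n ] (𝟙 (D (punchIn p a) p) ℤ.+ ∑[ b < n ] f′ a b)
  ≡⟨ trans (ℤP.+-identityˡ _) (∑-distrib-+ (λ a → 𝟙 (D (punchIn p a) p)) (λ a → ∑[ b < n ] f′ a b)) ⟩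
    ∑[ a < n ] 𝟙 (D (punchIn p a) p) ℤ.+ ∑[ a < n ] ∑[ b < n ] f′ a b
  ≡⟨ cong₂ ℤ._+_ (∑-arcs-into G p) (sym (des-ℤ D′ τ)) ⟩
    + lowerDegree G p ℤ.+ + des D′ τ
  ≡⟨ sym (ℤP.pos-+ (lowerDegree G p) (des D′ τ)) ⟩
    + (lowerDegree G p ℕ.+ des D′ τ)
  ∎)
  where
  open ≡-Reasoning
  σ  = extendAt p Fin.zero τ
  D  = orient G
  D′ = orient (deleteV G p)
  f : Fin (suc n) → Fin (suc n) → ℤ
  f u w = 𝟙 (D u w ∧ (toℕ (σ w) <ᵇ toℕ (σ u)))
  f′ : Fin n → Fin n → ℤ
  f′ a b = 𝟙 (D′ a b ∧ (toℕ (τ b) <ᵇ toℕ (τ a)))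
  row-p : ∑[ w < suc n ] f p w ≡ 0ℤ
  row-p = trans (∑-cong (suc n) (λ w → cong (λ z → 𝟙 (D p w ∧ (toℕ (σ w) <ᵇ toℕ z))) (extendAt-at p Fin.zero τ)))
                (trans (∑-cong (suc n) (λ w → cong 𝟙 (∧-zeroʳ (D p w)))) (∑-zero (suc n)))
  row-a : ∀ a → ∑[ w < suc n ] f (punchIn p a) w ≡ 𝟙 (D (punchIn p a) p) ℤ.+ ∑[ b < n ] f′ a b
  row-a a = trans (sum-remove {i = p} (f (punchIn p a))) (cong₂ ℤ._+_ into-p (∑-cong n elsewhere))
    where
    into-p : f (punchIn p a) p ≡ 𝟙 (D (punchIn p a) p)
    into-p rewrite extendAt-at p Fin.zero τ | extendAt-punchIn p Fin.zero τ a = cong 𝟙 (∧-identityʳ _)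
    elsewhere : ∀ b → f (punchIn p a) (punchIn p b) ≡ f′ a b
    elsewhere b rewrite extendAt-punchIn p Fin.zero τ a | extendAt-punchIn p Fin.zero τ b | orient-deleteV G p a b = refl

-- Splitting the bijections by the vertex labelled first.
A₋₁-deleteV : ∀ {n} (G : Graph (suc n)) → A₋₁ G ≡ ∑[ p < suc n ] (sgn (lowerDegree G p) ℤ.* A₋₁ (deleteV G p))
A₋₁-deleteV {n} G =
  trans (∑-bij-by-preimage n Fin.zero _ (sgn-des-respects (orient G)))
        (∑-cong (suc n) (λ p → trans (∑ˡ-cong (bijections n) (λ τ → trans (cong sgn (des-extendAt-zero G p τ))
                                                                             (sgn-+ (lowerDegree G p) (des (orient (deleteV G p)) τ))))
                                     (*-distribˡ-∑ˡ (bijections n) (sgn (lowerDegree G p)) (λ τ → sgn (des (orient (deleteV G p)) τ)))))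

∣∑ˡ∣≤∑ˡ∣∣ : ∀ {X : Set} (xs : List X) (f : X → ℤ) → ∣ listSum xs f ∣ ≤ sum (map (λ x → ∣ f x ∣) xs)
∣∑ˡ∣≤∑ˡ∣∣ []       f = ℕ.z≤n
∣∑ˡ∣≤∑ˡ∣∣ (x ∷ xs) f = ℕP.≤-trans (ℤP.∣i+j∣≤∣i∣+∣j∣ (f x) _) (ℕP.+-monoʳ-≤ ∣ f x ∣ (∣∑ˡ∣≤∑ˡ∣∣ xs f))

ν-deleteV : ∀ m (G : Graph (suc m)) → ν G ≤ sum (map (λ v → ν (deleteV G v)) (allFin (suc m)))
ν-deleteV m G = begin
    ∣ A₋₁ G ∣
  ≡⟨ cong ∣_∣ (trans (A₋₁-deleteV G) (sym (∑ˡ-allFin (suc m) term))) ⟩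
    ∣ listSum (allFin (suc m)) term ∣
  ≤⟨ ∣∑ˡ∣≤∑ˡ∣∣ (allFin (suc m)) term ⟩
    sum (map (λ p → ∣ term p ∣) (allFin (suc m)))
  ≡⟨ cong sum (map-cong (λ p → ∣sgn*∣ (lowerDegree G p) (A₋₁ (deleteV G p))) (allFin (suc m))) ⟩
    sum (map (λ v → ν (deleteV G v)) (allFin (suc m)))
  ∎
  where
  open ℕP.≤-Reasoning
  term : Fin (suc m) → ℤ
  term p = sgn (lowerDegree G p) ℤ.* A₋₁ (deleteV G p)

-- Parity and even sequences

<ᵇ-trichotomy : ∀ a b → a ≢ b → 𝟙 (a <ᵇ b) ℤ.+ 𝟙 (b <ᵇ a) ≡ 1ℤ
<ᵇ-trichotomy zero    zero    a≢b = ⊥-elim (a≢b refl)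
<ᵇ-trichotomy zero    (suc b) a≢b = refl
<ᵇ-trichotomy (suc a) zero    a≢b = refl
<ᵇ-trichotomy (suc a) (suc b) a≢b = <ᵇ-trichotomy a b (λ e → a≢b (cong suc e))

opposite-<ᵇ : ∀ {n} (a b : Fin n) → (toℕ (opposite a) <ᵇ toℕ (opposite b)) ≡ (toℕ b <ᵇ toℕ a)
opposite-<ᵇ {n} a b rewrite FinP.opposite-prop a | FinP.opposite-prop b =
  bool-ext (λ e → <⇒<ᵇ (reflect (<ᵇ⇒< e))) (λ e → <⇒<ᵇ (ℕP.∸-monoʳ-< (ℕ.s≤s (<ᵇ⇒< e)) (FinP.toℕ<n a)))
  where
  reflect : n ∸ suc (toℕ a) ℕ.< n ∸ suc (toℕ b) → toℕ b ℕ.< toℕ a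
  reflect lt with ℕP.<-cmp (toℕ b) (toℕ a)
  ... | tri< b<a _ _ = b<a
  ... | tri≈ _ b≡a _ rewrite b≡a = ⊥-elim (ℕP.<-irrefl refl lt)
  ... | tri> _ _ a<b = ⊥-elim (ℕP.<-asym lt (ℕP.∸-monoʳ-< (ℕ.s≤s a<b) (FinP.toℕ<n b)))

opposite-injective : ∀ {n} → Injective _≡_ _≡_ (opposite {n})
opposite-injective {x = x} {y} e = trans (sym (FinP.opposite-involutive x)) (trans (cong opposite e) (FinP.opposite-involutive y))

edges : ∀ {n} → Graph n → ℕ
edges {n} G = count (λ x → orient G (proj₁ x) (proj₂ x)) (pairs n)

edges-ℤ : ∀ {n} (G : Graph n) → + edges G ≡ ∑[ u < n ] ∑[ w < n ] 𝟙 (orient G u w)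
edges-ℤ {n} G = trans (count≡∑ˡ _ (pairs n)) (∑ˡ-pairs n _)

orient-≢ : ∀ {n} (G : Graph n) u w → orient G u w ≡ true → u ≢ w
orient-≢ G u w uw refl = case (trans (sym (orient-irrefl G u)) uw)
  where
  case : false ≡ true → ⊥
  case ()

-- reversing the labels turns the descents into the ascents
des-opposite : ∀ {n} (G : Graph n) (σ : Fin n → Fin n) → Injective _≡_ _≡_ σ →
  des (orient G) (λ x → opposite (σ x)) ℕ.+ des (orient G) σ ≡ edges G
des-opposite {n} G σ inj = ℤP.+-injective (begin
    + (des D σ′ ℕ.+ des D σ)
  ≡⟨ trans (ℤP.pos-+ (des D σ′) (des D σ)) (cong₂ ℤ._+_ (des-ℤ D σ′) (des-ℤ D σ)) ⟩
    ∑[ u < n ] ∑[ w < n ] 𝟙 (D u w ∧ (toℕ (σ′ w) <ᵇ toℕ (σ′ u))) ℤ.+ ∑[ u < n ] ∑[ w < n ] 𝟙 (D u w ∧ (toℕ (σ w) <ᵇ toℕ (σ u)))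
  ≡⟨ sym (∑-distrib-+ (λ u → ∑[ w < n ] 𝟙 (D u w ∧ (toℕ (σ′ w) <ᵇ toℕ (σ′ u)))) (λ u → ∑[ w < n ] 𝟙 (D u w ∧ (toℕ (σ w) <ᵇ toℕ (σ u))))) ⟩
    ∑[ u < n ] (∑[ w < n ] 𝟙 (D u w ∧ (toℕ (σ′ w) <ᵇ toℕ (σ′ u))) ℤ.+ ∑[ w < n ] 𝟙 (D u w ∧ (toℕ (σ w) <ᵇ toℕ (σ u))))
  ≡⟨ ∑-cong n (λ u → trans (sym (∑-distrib-+ {n} _ _)) (∑-cong n (each u))) ⟩
    ∑[ u < n ] ∑[ w < n ] 𝟙 (D u w)
  ≡⟨ sym (edges-ℤ G) ⟩
    + edges G
  ∎)
  where
  open ≡-Reasoning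
  D = orient G
  σ′ = λ x → opposite (σ x)
  each : ∀ u w → 𝟙 (D u w ∧ (toℕ (σ′ w) <ᵇ toℕ (σ′ u))) ℤ.+ 𝟙 (D u w ∧ (toℕ (σ w) <ᵇ toℕ (σ u))) ≡ 𝟙 (D u w)
  each u w rewrite opposite-<ᵇ (σ w) (σ u) with D u w in uw
  ... | true  = <ᵇ-trichotomy (toℕ (σ u)) (toℕ (σ w)) (λ e → orient-≢ G u w uw (inj (FinP.toℕ-injective e)))
  ... | false = refl

sgn-sq : ∀ k → sgn k ℤ.* sgn k ≡ 1ℤ
sgn-sq zero    = refl
sgn-sq (suc k) = trans (square-neg (sgn k)) (sgn-sq k)
  where
  square-neg : ∀ s → (-1ℤ ℤ.* s) ℤ.* (-1ℤ ℤ.* s) ≡ s ℤ.* s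
  square-neg = solve-∀

sgn-odd : ∀ k → (k % 2 ≡ᵇ 0) ≡ false → sgn k ≡ -1ℤ
sgn-odd (suc zero)    _   = refl
sgn-odd (suc (suc k)) odd = trans (neg-neg (sgn k)) (sgn-odd k odd)
  where
  neg-neg : ∀ s → -1ℤ ℤ.* (-1ℤ ℤ.* s) ≡ s
  neg-neg = solve-∀

-- Composing with the reversal changes every sign when the number of edges is odd.
A₋₁-odd : ∀ {n} (G : Graph n) → (edges G % 2 ≡ᵇ 0) ≡ false → A₋₁ G ≡ 0ℤ
A₋₁-odd {n} G odd = self-neg (A₋₁ G) (trans (∑-bij-∘ˡ n opposite opposite-injective _ (sgn-des-respects (orient G)))
                                            (trans (∑-bij-cong n _ _ flips) (∑ˡ-neg (bijections n) _)))
  where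
  self-neg : ∀ x → x ≡ - x → x ≡ 0ℤ
  self-neg (+ zero)  e = refl
  self-neg (+ suc n) ()
  self-neg ℤ.-[1+ n ] ()
  flips : ∀ σ → Injective _≡_ _≡_ σ → sgn (des (orient G) (λ x → opposite (σ x))) ≡ - sgn (des (orient G) σ)
  flips σ inj = begin
      sgn d′
    ≡⟨ sym (ℤP.*-identityʳ _) ⟩
      sgn d′ ℤ.* 1ℤ
    ≡⟨ cong (sgn d′ ℤ.*_) (sym (sgn-sq d)) ⟩
      sgn d′ ℤ.* (sgn d ℤ.* sgn d)
    ≡⟨ sym (ℤP.*-assoc (sgn d′) _ _) ⟩
      (sgn d′ ℤ.* sgn d) ℤ.* sgn d
    ≡⟨ cong (ℤ._* sgn d) (trans (sym (sgn-+ d′ d)) (trans (cong sgn (des-opposite G σ inj)) (sgn-odd (edges G) odd))) ⟩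
      -1ℤ ℤ.* sgn d
    ≡⟨ ℤP.-1*i≡-i _ ⟩
      - sgn d
    ∎
    where
    open ≡-Reasoning
    d′ = des (orient G) (λ x → opposite (σ x))
    d  = des (orient G) σ

prefixEdges-ℤ : ∀ {n} (G : Graph n) π i →
  + prefixEdges G π i ≡ ∑[ a < n ] ∑[ b < n ] 𝟙 ((toℕ a <ᵇ toℕ b) ∧ (toℕ b <ᵇ i) ∧ adj G (π a) (π b))
prefixEdges-ℤ {n} G π i = trans (count≡∑ˡ _ (pairs n)) (∑ˡ-pairs n _)

toℕ-punchIn-last : ∀ {n} (j : Fin n) → toℕ (punchIn (fromℕ n) j) ≡ toℕ j
toℕ-punchIn-last {suc n} Fin.zero    = refl
toℕ-punchIn-last {suc n} (Fin.suc j) = cong suc (toℕ-punchIn-last j)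

-- The first i ≤ n positions of extendAt (fromℕ n) w τ avoid the last position, which holds w.
prefixEdges-extendAt-last : ∀ {n} (G : Graph (suc n)) w (τ : Fin n → Fin n) i → i ≤ n →
  prefixEdges G (extendAt (fromℕ n) w τ) i ≡ prefixEdges (deleteV G w) τ i
prefixEdges-extendAt-last {n} G w τ i i≤n = ℤP.+-injective (begin
    + prefixEdges G π i
  ≡⟨ prefixEdges-ℤ G π i ⟩
    ∑[ a < suc n ] ∑[ b < suc n ] f a b
  ≡⟨ sum-remove {i = last} (λ a → ∑[ b < suc n ] f a b) ⟩
    ∑[ b < suc n ] f last b ℤ.+ ∑[ a < n ] ∑[ b < suc n ] f (punchIn last a) b
  ≡⟨ cong₂ ℤ._+_ row-last (∑-cong n row-a) ⟩
    0ℤ ℤ.+ ∑[ a < n ] ∑[ b < n ] 𝟙 ((toℕ a <ᵇ toℕ b) ∧ (toℕ b <ᵇ i) ∧ adj (deleteV G w) (τ a) (τ b))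
  ≡⟨ trans (ℤP.+-identityˡ _) (sym (prefixEdges-ℤ (deleteV G w) τ i)) ⟩
    + prefixEdges (deleteV G w) τ i
  ∎)
  where
  open ≡-Reasoning
  last = fromℕ n
  π = extendAt last w τ
  f : Fin (suc n) → Fin (suc n) → ℤ
  f a b = 𝟙 ((toℕ a <ᵇ toℕ b) ∧ (toℕ b <ᵇ i) ∧ adj G (π a) (π b))
  row-last : ∑[ b < suc n ] f last b ≡ 0ℤ
  row-last = trans (∑-cong (suc n) (λ b → cong (λ z → 𝟙 (z ∧ ((toℕ b <ᵇ i) ∧ adj G (π last) (π b))))
                                         (trans (cong (_<ᵇ toℕ b) (FinP.toℕ-fromℕ n)) (≤⇒<ᵇ-false (ℕ.s≤s⁻¹ (FinP.toℕ<n b))))))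
                   (∑-zero (suc n))
  row-a : ∀ a → ∑[ b < suc n ] f (punchIn last a) b ≡ ∑[ b < n ] 𝟙 ((toℕ a <ᵇ toℕ b) ∧ (toℕ b <ᵇ i) ∧ adj (deleteV G w) (τ a) (τ b))
  row-a a = trans (sum-remove {i = last} (f (punchIn last a))) (trans (cong₂ ℤ._+_ column-last (∑-cong n rest)) (ℤP.+-identityˡ _))
    where
    column-last : f (punchIn last a) last ≡ 0ℤ
    column-last rewrite FinP.toℕ-fromℕ n | ≤⇒<ᵇ-false i≤n = cong 𝟙 (∧-zeroʳ _)
    rest : ∀ b → f (punchIn last a) (punchIn last b) ≡ 𝟙 ((toℕ a <ᵇ toℕ b) ∧ (toℕ b <ᵇ i) ∧ adj (deleteV G w) (τ a) (τ b))
    rest b rewrite toℕ-punchIn-last a | toℕ-punchIn-last b | extendAt-punchIn last w τ a | extendAt-punchIn last w τ b = refl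

IsTournament : ∀ {n} → (Fin n → Fin n → Bool) → Set
IsTournament {n} φ = ∀ (a b : Fin n) → a ≢ b → 𝟙 (φ a b) ℤ.+ 𝟙 (φ b a) ≡ 1ℤ

-- Each edge {a, b} of a symmetric irreflexive relation is counted once by any tournament.
∑-tournament : ∀ n (A : Fin n → Fin n → Bool) → (∀ a b → A a b ≡ A b a) → (∀ a → A a a ≡ false) →
  ∀ φ → IsTournament φ →
  ∑[ a < n ] ∑[ b < n ] 𝟙 (φ a b ∧ A a b) ℤ.+ ∑[ a < n ] ∑[ b < n ] 𝟙 (φ a b ∧ A a b) ≡ ∑[ a < n ] ∑[ b < n ] 𝟙 (A a b)
∑-tournament n A A-sym A-irrefl φ φ-tournament = begin
    once ℤ.+ once
  ≡⟨ cong (ℤ._+_ once) (trans (∑-comm (λ a b → 𝟙 (φ a b ∧ A a b)))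
                          (∑-cong n (λ a → ∑-cong n (λ b → cong (λ z → 𝟙 (φ b a ∧ z)) (A-sym b a))))) ⟩
    once ℤ.+ ∑[ a < n ] ∑[ b < n ] 𝟙 (φ b a ∧ A a b)
  ≡⟨ sym (∑-distrib-+ {n} _ _) ⟩
    ∑[ a < n ] (∑[ b < n ] 𝟙 (φ a b ∧ A a b) ℤ.+ ∑[ b < n ] 𝟙 (φ b a ∧ A a b))
  ≡⟨ ∑-cong n (λ a → trans (sym (∑-distrib-+ {n} _ _)) (∑-cong n (each a))) ⟩
    ∑[ a < n ] ∑[ b < n ] 𝟙 (A a b)
  ∎
  where
  open ≡-Reasoning
  once = ∑[ a < n ] ∑[ b < n ] 𝟙 (φ a b ∧ A a b)
  each : ∀ a b → 𝟙 (φ a b ∧ A a b) ℤ.+ 𝟙 (φ b a ∧ A a b) ≡ 𝟙 (A a b)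
  each a b with a FinP.≟ b
  ... | yes refl rewrite A-irrefl a | ∧-zeroʳ (φ a a) = refl
  ... | no a≢b with A a b
  ... | true  rewrite ∧-identityʳ (φ a b) | ∧-identityʳ (φ b a) = φ-tournament a b a≢b
  ... | false rewrite ∧-zeroʳ (φ a b) | ∧-zeroʳ (φ b a) = refl

half-unique : ∀ x y → x ℤ.+ x ≡ y ℤ.+ y → x ≡ y
half-unique x y e = ℤP.*-cancelˡ-≡ (+ 2) x y (trans (double x) (trans e (sym (double y))))
  where
  double : ∀ z → + 2 ℤ.* z ≡ z ℤ.+ z
  double = solve-∀

-- The full prefix is the whole graph: count its edges by the order of the positions, then of the
-- vertices, and relabel.
prefixEdges-all : ∀ {n} (G : Graph n) (π : Fin n → Fin n) → Injective _≡_ _≡_ π → prefixEdges G π n ≡ edges G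
prefixEdges-all {n} G π inj = ℤP.+-injective (begin
    + prefixEdges G π n
  ≡⟨ prefixEdges-ℤ G π n ⟩
    ∑[ a < n ] ∑[ b < n ] 𝟙 ((toℕ a <ᵇ toℕ b) ∧ (toℕ b <ᵇ n) ∧ Aπ a b)
  ≡⟨ ∑-cong n (λ a → ∑-cong n (λ b → cong (λ z → 𝟙 ((toℕ a <ᵇ toℕ b) ∧ z ∧ Aπ a b)) (<⇒<ᵇ (FinP.toℕ<n b)))) ⟩
    ∑[ a < n ] ∑[ b < n ] 𝟙 ((toℕ a <ᵇ toℕ b) ∧ Aπ a b)
  ≡⟨ half-unique _ _ (trans (∑-tournament n Aπ Aπ-sym (λ a → irrefl G (π a)) _ position-order)
                            (sym (∑-tournament n Aπ Aπ-sym (λ a → irrefl G (π a)) _ label-order))) ⟩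
    ∑[ a < n ] ∑[ b < n ] 𝟙 ((toℕ (π a) <ᵇ toℕ (π b)) ∧ Aπ a b)
  ≡⟨ trans (∑-cong n (λ a → ∑-reindex n π inj (h (π a)))) (∑-reindex n π inj (λ u → ∑[ w < n ] h u w)) ⟩
    ∑[ u < n ] ∑[ w < n ] h u w
  ≡⟨ ∑-cong n (λ u → ∑-cong n (λ w → cong 𝟙 (∧-comm (toℕ u <ᵇ toℕ w) (adj G u w)))) ⟩
    ∑[ u < n ] ∑[ w < n ] 𝟙 (orient G u w)
  ≡⟨ sym (edges-ℤ G) ⟩
    + edges G
  ∎)
  where
  open ≡-Reasoning
  Aπ : Fin n → Fin n → Bool
  Aπ a b = adj G (π a) (π b)
  Aπ-sym : ∀ a b → Aπ a b ≡ Aπ b a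
  Aπ-sym a b = adj-sym G (π a) (π b)
  position-order : IsTournament (λ a b → toℕ a <ᵇ toℕ b)
  position-order a b a≢b = <ᵇ-trichotomy (toℕ a) (toℕ b) (λ e → a≢b (FinP.toℕ-injective e))
  label-order : IsTournament (λ a b → toℕ (π a) <ᵇ toℕ (π b))
  label-order a b a≢b = <ᵇ-trichotomy (toℕ (π a)) (toℕ (π b)) (λ e → a≢b (inj (FinP.toℕ-injective e)))
  h : Fin n → Fin n → ℤ
  h u w = 𝟙 ((toℕ u <ᵇ toℕ w) ∧ adj G u w)

allᵇ-upTo-suc : ∀ (q : ℕ → Bool) m → allᵇ q (upTo (suc m)) ≡ (allᵇ q (upTo m) ∧ q m)
allᵇ-upTo-suc q m =
  trans (cong (allᵇ q) (sym (upTo-∷ʳ m))) (trans (allᵇ-++ q (upTo m) (m ∷ [])) (cong (allᵇ q (upTo m) ∧_) (∧-identityʳ (q m))))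

allᵇ-upTo-cong : ∀ (q q′ : ℕ → Bool) m → (∀ i → i ℕ.< m → q i ≡ q′ i) → allᵇ q (upTo m) ≡ allᵇ q′ (upTo m)
allᵇ-upTo-cong q q′ zero    same = refl
allᵇ-upTo-cong q q′ (suc m) same =
  trans (allᵇ-upTo-suc q m)
        (trans (cong₂ _∧_ (allᵇ-upTo-cong q q′ m (λ i i<m → same i (ℕP.m<n⇒m<1+n i<m))) (same m (ℕP.n<1+n m)))
               (sym (allᵇ-upTo-suc q′ m)))

hasEvenEdges : ∀ {n} → Graph n → Bool
hasEvenEdges G = edges G % 2 ≡ᵇ 0

isEvenSeq-extendAt-last : ∀ {n} (G : Graph (suc n)) w (τ : Fin n → Fin n) → Injective _≡_ _≡_ τ →
  isEvenSeqᵇ G (extendAt (fromℕ n) w τ) ≡ (isEvenSeqᵇ (deleteV G w) τ ∧ hasEvenEdges G)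
isEvenSeq-extendAt-last {n} G w τ inj =
  trans (allᵇ-upTo-suc (λ i → prefixEdges G π i % 2 ≡ᵇ 0) (suc n))
        (cong₂ _∧_ (allᵇ-upTo-cong (λ i → prefixEdges G π i % 2 ≡ᵇ 0) (λ i → prefixEdges (deleteV G w) τ i % 2 ≡ᵇ 0) (suc n) (λ i i<1+n → cong (λ z → z % 2 ≡ᵇ 0) (prefixEdges-extendAt-last G w τ i (ℕ.s≤s⁻¹ i<1+n))))
                   (cong (λ z → z % 2 ≡ᵇ 0) (prefixEdges-all G π (extendAt-injective (fromℕ n) w τ inj))))
  where
  π = extendAt (fromℕ n) w τ

isEvenSeq-respects : ∀ {n} (G : Graph n) → RespectsValues (λ π → 𝟙 (isEvenSeqᵇ G π))
isEvenSeq-respects {n} G π π′ π≗π′ = cong 𝟙 (allᵇ-upTo-cong (λ i → prefixEdges G π i % 2 ≡ᵇ 0) (λ i → prefixEdges G π′ i % 2 ≡ᵇ 0) (suc n) (λ i _ → cong (λ z → z % 2 ≡ᵇ 0)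
  (count-cong (λ { (a , b) → cong₂ (λ x y → (toℕ a <ᵇ toℕ b) ∧ (toℕ b <ᵇ i) ∧ adj G x y) (π≗π′ a) (π≗π′ b) }) (pairs n))))

-- Splitting the even sequences by their last vertex.
η-deleteV : ∀ {n} (G : Graph (suc n)) → + η G ≡ ∑[ w < suc n ] (𝟙 (hasEvenEdges G) ℤ.* + η (deleteV G w))
η-deleteV {n} G = begin
    + η G
  ≡⟨ count≡∑ˡ (isEvenSeqᵇ G) (bijections (suc n)) ⟩
    ∑[ π ∈ bijections (suc n) ] 𝟙 (isEvenSeqᵇ G π)
  ≡⟨ ∑-bij-by-value n (fromℕ n) _ (isEvenSeq-respects G) ⟩
    ∑[ w < suc n ] ∑[ τ ∈ bijections n ] 𝟙 (isEvenSeqᵇ G (extendAt (fromℕ n) w τ))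
  ≡⟨ ∑-cong (suc n) (λ w → ∑-bij-cong n _ _ (λ τ inj → trans (cong 𝟙 (isEvenSeq-extendAt-last G w τ inj))
                                                                (𝟙-∧-* (isEvenSeqᵇ (deleteV G w) τ) (hasEvenEdges G)))) ⟩
    ∑[ w < suc n ] ∑[ τ ∈ bijections n ] (𝟙 (hasEvenEdges G) ℤ.* 𝟙 (isEvenSeqᵇ (deleteV G w) τ))
  ≡⟨ ∑-cong (suc n) (λ w → trans (*-distribˡ-∑ˡ (bijections n) (𝟙 (hasEvenEdges G)) _)
                                 (cong (𝟙 (hasEvenEdges G) ℤ.*_) (sym (count≡∑ˡ (isEvenSeqᵇ (deleteV G w)) (bijections n))))) ⟩
    ∑[ w < suc n ] (𝟙 (hasEvenEdges G) ℤ.* + η (deleteV G w))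
  ∎
  where open ≡-Reasoning

∑ℕ≡∑ : ∀ n (f : Fin n → ℕ) → + sum (map f (allFin n)) ≡ ∑[ i < n ] (+ f i)
∑ℕ≡∑ n f = trans (go (allFin n)) (∑ˡ-allFin n (λ i → + f i))
  where
  go : ∀ xs → + sum (map f xs) ≡ listSum xs (λ i → + f i)
  go []       = refl
  go (x ∷ xs) = trans (ℤP.pos-+ (f x) _) (cong (ℤ._+_ (+ f x)) (go xs))

sum-map-mono : ∀ {X : Set} {f g : X → ℕ} → (∀ x → f x ≤ g x) → ∀ xs → sum (map f xs) ≤ sum (map g xs)
sum-map-mono f≤g []       = ℕ.z≤n
sum-map-mono f≤g (x ∷ xs) = ℕP.+-mono-≤ (f≤g x) (sum-map-mono f≤g xs)

ν≤η : ∀ n (G : Graph n) → ν G ≤ η G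
ν≤η zero    G = ℕP.≤-refl
ν≤η (suc m) G with hasEvenEdges G in even
... | true  = ℕP.≤-trans (ν-deleteV m G)
                (ℕP.≤-trans (sum-map-mono (λ v → ν≤η m (deleteV G v)) (allFin (suc m))) (ℕP.≤-reflexive (sym η-even)))
  where
  η-even : η G ≡ sum (map (λ v → η (deleteV G v)) (allFin (suc m)))
  η-even = ℤP.+-injective (trans (η-deleteV G)
    (trans (∑-cong (suc m) (λ w → trans (cong (λ b → 𝟙 b ℤ.* + η (deleteV G w)) even) (ℤP.*-identityˡ _)))
           (sym (∑ℕ≡∑ (suc m) (λ v → η (deleteV G v))))))
... | false rewrite A₋₁-odd G even = ℕ.z≤n

-- Gaussian polynomials

infix 4 _≋_
record _≋_ (p q : Poly) : Set where
  constructor mk≋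
  field coeffs : p ≈ₚ q
open _≋_

≋-setoid : Setoid 0ℓ 0ℓ
≋-setoid = record
  { Carrier = Poly ; _≈_ = _≋_
  ; isEquivalence = record
    { refl  = mk≋ (λ k → refl)
    ; sym   = λ (mk≋ e) → mk≋ (λ k → sym (e k))
    ; trans = λ (mk≋ e) (mk≋ f) → mk≋ (λ k → trans (e k) (f k))
    }
  }

open Setoid ≋-setoid using () renaming (refl to ≋-refl; sym to ≋-sym; trans to ≋-trans)
module ≋-Reasoning = Relation.Binary.Reasoning.Setoid ≋-setoid

tailₚ : Poly → Poly
tailₚ []      = []
tailₚ (a ∷ p) = p

coeff-suc : ∀ p k → coeff p (suc k) ≡ coeff (tailₚ p) k
coeff-suc []      k = refl
coeff-suc (a ∷ p) k = refl

coeff-+ₚ : ∀ p q k → coeff (p +ₚ q) k ≡ coeff p k ℤ.+ coeff q k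
coeff-+ₚ []      q       k       = sym (ℤP.+-identityˡ _)
coeff-+ₚ (a ∷ p) []      k       = sym (ℤP.+-identityʳ _)
coeff-+ₚ (a ∷ p) (b ∷ q) zero    = refl
coeff-+ₚ (a ∷ p) (b ∷ q) (suc k) = coeff-+ₚ p q k

coeff-scale : ∀ a q k → coeff (map (a ℤ.*_) q) k ≡ a ℤ.* coeff q k
coeff-scale a []      k       = sym (ℤP.*-zeroʳ a)
coeff-scale a (b ∷ q) zero    = refl
coeff-scale a (b ∷ q) (suc k) = coeff-scale a q k

coeff-scaleʳ : ∀ a q k → coeff (map (ℤ._* a) q) k ≡ coeff q k ℤ.* a
coeff-scaleʳ a []      k       = sym (ℤP.*-zeroˡ a)
coeff-scaleʳ a (b ∷ q) zero    = refl
coeff-scaleʳ a (b ∷ q) (suc k) = coeff-scaleʳ a q k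

coeff-*ₚ-zero : ∀ p q → coeff (p *ₚ q) 0 ≡ coeff p 0 ℤ.* coeff q 0
coeff-*ₚ-zero []      q = sym (ℤP.*-zeroˡ (coeff q 0))
coeff-*ₚ-zero (a ∷ p) q = trans (coeff-+ₚ (map (a ℤ.*_) q) (0ℤ ∷ p *ₚ q) 0) (trans (ℤP.+-identityʳ _) (coeff-scale a q 0))

coeff-*ₚ-suc : ∀ p q k → coeff (p *ₚ q) (suc k) ≡ coeff p 0 ℤ.* coeff q (suc k) ℤ.+ coeff (tailₚ p *ₚ q) k
coeff-*ₚ-suc []      q k = sym (trans (cong (ℤ._+ coeff ([] *ₚ q) k) (ℤP.*-zeroˡ (coeff q (suc k)))) (ℤP.+-identityˡ _))
coeff-*ₚ-suc (a ∷ p) q k = trans (coeff-+ₚ (map (a ℤ.*_) q) (0ℤ ∷ p *ₚ q) (suc k)) (cong (ℤ._+ coeff (p *ₚ q) k) (coeff-scale a q (suc k)))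

+ₚ-cong : ∀ {p p′ q q′} → p ≋ p′ → q ≋ q′ → (p +ₚ q) ≋ (p′ +ₚ q′)
+ₚ-cong {p} {p′} {q} {q′} (mk≋ e) (mk≋ f) =
  mk≋ (λ k → trans (coeff-+ₚ p q k) (trans (cong₂ ℤ._+_ (e k) (f k)) (sym (coeff-+ₚ p′ q′ k))))

∷-cong : ∀ a {p q} → p ≋ q → (a ∷ p) ≋ (a ∷ q)
∷-cong a (mk≋ e) = mk≋ (λ { zero → refl ; (suc k) → e k })

scale-cong : ∀ a {p q} → p ≋ q → map (a ℤ.*_) p ≋ map (a ℤ.*_) q
scale-cong a {p} {q} (mk≋ e) = mk≋ (λ k → trans (coeff-scale a p k) (trans (cong (a ℤ.*_) (e k)) (sym (coeff-scale a q k))))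

*ₚ-congˡ : ∀ p {q q′} → q ≋ q′ → (p *ₚ q) ≋ (p *ₚ q′)
*ₚ-congˡ []      e = ≋-refl
*ₚ-congˡ (a ∷ p) e = +ₚ-cong (scale-cong a e) (∷-cong 0ℤ (*ₚ-congˡ p e))

*ₚ-congʳ : ∀ {p p′} q → p ≋ p′ → (p *ₚ q) ≋ (p′ *ₚ q)
*ₚ-congʳ {p} {p′} q (mk≋ e) = mk≋ (λ k → go k p p′ e)
  where
  go : ∀ k p p′ → p ≈ₚ p′ → coeff (p *ₚ q) k ≡ coeff (p′ *ₚ q) k
  go zero    p p′ e = trans (coeff-*ₚ-zero p q) (trans (cong (ℤ._* coeff q 0) (e 0)) (sym (coeff-*ₚ-zero p′ q)))
  go (suc k) p p′ e =
    trans (coeff-*ₚ-suc p q k)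
          (trans (cong₂ ℤ._+_ (cong (ℤ._* coeff q (suc k)) (e 0))
                              (go k (tailₚ p) (tailₚ p′) (λ j → trans (sym (coeff-suc p j)) (trans (e (suc j)) (coeff-suc p′ j)))))
                 (sym (coeff-*ₚ-suc p′ q k)))

*ₚ-zeroʳ : ∀ p → (p *ₚ []) ≋ []
*ₚ-zeroʳ p = mk≋ (go p)
  where
  go : ∀ p k → coeff (p *ₚ []) k ≡ coeff [] k
  go []      k       = refl
  go (a ∷ p) zero    = refl
  go (a ∷ p) (suc k) = go p k

*ₚ-∷ʳ : ∀ p b q → (p *ₚ (b ∷ q)) ≋ (map (ℤ._* b) p +ₚ (0ℤ ∷ p *ₚ q))
*ₚ-∷ʳ p b q = mk≋ (go p)
  where
  go : ∀ p k → coeff (p *ₚ (b ∷ q)) k ≡ coeff (map (ℤ._* b) p +ₚ (0ℤ ∷ p *ₚ q)) k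
  go []      zero    = refl
  go []      (suc k) = refl
  go (a ∷ p) zero    = refl
  go (a ∷ p) (suc k) = begin
      coeff (map (a ℤ.*_) q +ₚ (p *ₚ (b ∷ q))) k
    ≡⟨ coeff-+ₚ (map (a ℤ.*_) q) (p *ₚ (b ∷ q)) k ⟩
      coeff (map (a ℤ.*_) q) k ℤ.+ coeff (p *ₚ (b ∷ q)) k
    ≡⟨ cong (ℤ._+_ (coeff (map (a ℤ.*_) q) k)) (trans (go p k) (coeff-+ₚ (map (ℤ._* b) p) (0ℤ ∷ p *ₚ q) k)) ⟩
      coeff (map (a ℤ.*_) q) k ℤ.+ (coeff (map (ℤ._* b) p) k ℤ.+ coeff (0ℤ ∷ p *ₚ q) k)
    ≡⟨ +-exchange (coeff (map (a ℤ.*_) q) k) (coeff (map (ℤ._* b) p) k) (coeff (0ℤ ∷ p *ₚ q) k) ⟩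
      coeff (map (ℤ._* b) p) k ℤ.+ (coeff (map (a ℤ.*_) q) k ℤ.+ coeff (0ℤ ∷ p *ₚ q) k)
    ≡⟨ sym (trans (coeff-+ₚ (map (ℤ._* b) p) (map (a ℤ.*_) q +ₚ (0ℤ ∷ p *ₚ q)) k)
                  (cong (ℤ._+_ (coeff (map (ℤ._* b) p) k)) (coeff-+ₚ (map (a ℤ.*_) q) (0ℤ ∷ p *ₚ q) k))) ⟩
      coeff (map (ℤ._* b) p +ₚ (map (a ℤ.*_) q +ₚ (0ℤ ∷ p *ₚ q))) k
    ∎
    where open ≡-Reasoning

*ₚ-comm : ∀ p q → (p *ₚ q) ≋ (q *ₚ p)
*ₚ-comm []      q = ≋-sym (*ₚ-zeroʳ q)
*ₚ-comm (a ∷ p) q =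
  ≋-sym (≋-trans (*ₚ-∷ʳ q a p)
                 (+ₚ-cong (mk≋ (λ k → trans (coeff-scaleʳ a q k) (trans (ℤP.*-comm _ a) (sym (coeff-scale a q k)))))
                          (∷-cong 0ℤ (*ₚ-comm q p))))

*ₚ-distribˡ : ∀ p q r → (p *ₚ (q +ₚ r)) ≋ ((p *ₚ q) +ₚ (p *ₚ r))
*ₚ-distribˡ []      q r = ≋-refl
*ₚ-distribˡ (a ∷ p) q r = mk≋ λ k → begin
    coeff (map (a ℤ.*_) (q +ₚ r) +ₚ (0ℤ ∷ p *ₚ (q +ₚ r))) k
  ≡⟨ coeff-+ₚ (map (a ℤ.*_) (q +ₚ r)) (0ℤ ∷ p *ₚ (q +ₚ r)) k ⟩
    coeff (map (a ℤ.*_) (q +ₚ r)) k ℤ.+ coeff (0ℤ ∷ p *ₚ (q +ₚ r)) k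
  ≡⟨ cong₂ ℤ._+_ (trans (coeff-scale a (q +ₚ r) k) (trans (cong (a ℤ.*_) (coeff-+ₚ q r k)) (ℤP.*-distribˡ-+ a _ _)))
                 (trans (coeffs (∷-cong 0ℤ (*ₚ-distribˡ p q r)) k) (shifted k)) ⟩
    (a ℤ.* coeff q k ℤ.+ a ℤ.* coeff r k) ℤ.+ (coeff (0ℤ ∷ p *ₚ q) k ℤ.+ coeff (0ℤ ∷ p *ₚ r) k)
  ≡⟨ +-interchange (a ℤ.* coeff q k) (a ℤ.* coeff r k) _ _ ⟩
    (a ℤ.* coeff q k ℤ.+ coeff (0ℤ ∷ p *ₚ q) k) ℤ.+ (a ℤ.* coeff r k ℤ.+ coeff (0ℤ ∷ p *ₚ r) k)
  ≡⟨ sym (trans (coeff-+ₚ ((a ∷ p) *ₚ q) ((a ∷ p) *ₚ r) k)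
                (cong₂ ℤ._+_ (trans (coeff-+ₚ (map (a ℤ.*_) q) (0ℤ ∷ p *ₚ q) k) (cong (ℤ._+ _) (coeff-scale a q k)))
                             (trans (coeff-+ₚ (map (a ℤ.*_) r) (0ℤ ∷ p *ₚ r) k) (cong (ℤ._+ _) (coeff-scale a r k))))) ⟩
    coeff (((a ∷ p) *ₚ q) +ₚ ((a ∷ p) *ₚ r)) k
  ∎
  where
  open ≡-Reasoning
  shifted : ∀ k → coeff (0ℤ ∷ ((p *ₚ q) +ₚ (p *ₚ r))) k ≡ coeff (0ℤ ∷ p *ₚ q) k ℤ.+ coeff (0ℤ ∷ p *ₚ r) k
  shifted zero    = refl
  shifted (suc k) = coeff-+ₚ (p *ₚ q) (p *ₚ r) k

*ₚ-distribʳ : ∀ q r p → ((q +ₚ r) *ₚ p) ≋ ((q *ₚ p) +ₚ (r *ₚ p))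
*ₚ-distribʳ q r p = ≋-trans (*ₚ-comm (q +ₚ r) p) (≋-trans (*ₚ-distribˡ p q r) (+ₚ-cong (*ₚ-comm p q) (*ₚ-comm p r)))

0∷-*ₚ : ∀ s r → ((0ℤ ∷ s) *ₚ r) ≋ (0ℤ ∷ (s *ₚ r))
0∷-*ₚ s r = mk≋ (λ k → trans (coeff-+ₚ (map (0ℤ ℤ.*_) r) (0ℤ ∷ s *ₚ r) k)
                             (trans (cong (ℤ._+ coeff (0ℤ ∷ s *ₚ r) k) (trans (coeff-scale 0ℤ r k) (ℤP.*-zeroˡ (coeff r k))))
                                    (ℤP.+-identityˡ _)))

scale-*ₚ : ∀ a q r → (map (a ℤ.*_) q *ₚ r) ≋ map (a ℤ.*_) (q *ₚ r)
scale-*ₚ a q r = mk≋ (go q)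
  where
  go : ∀ q k → coeff (map (a ℤ.*_) q *ₚ r) k ≡ coeff (map (a ℤ.*_) (q *ₚ r)) k
  go []      k = refl
  go (b ∷ q) k =
    trans (coeff-+ₚ (map ((a ℤ.* b) ℤ.*_) r) (0ℤ ∷ map (a ℤ.*_) q *ₚ r) k)
          (trans (cong₂ ℤ._+_ (coeff-scale (a ℤ.* b) r k) (shifted k))
                 (sym (trans (coeff-scale a (map (b ℤ.*_) r +ₚ (0ℤ ∷ q *ₚ r)) k)
                             (trans (cong (a ℤ.*_) (coeff-+ₚ (map (b ℤ.*_) r) (0ℤ ∷ q *ₚ r) k))
                                    (trans (ℤP.*-distribˡ-+ a _ _)
                                           (cong₂ ℤ._+_ (trans (cong (a ℤ.*_) (coeff-scale b r k)) (sym (ℤP.*-assoc a b _)))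
                                                        (scaled k)))))))
    where
    shifted : ∀ k → coeff (0ℤ ∷ map (a ℤ.*_) q *ₚ r) k ≡ coeff (0ℤ ∷ map (a ℤ.*_) (q *ₚ r)) k
    shifted zero    = refl
    shifted (suc k) = go q k
    scaled : ∀ k → a ℤ.* coeff (0ℤ ∷ q *ₚ r) k ≡ coeff (0ℤ ∷ map (a ℤ.*_) (q *ₚ r)) k
    scaled zero    = ℤP.*-zeroʳ a
    scaled (suc k) = sym (coeff-scale a (q *ₚ r) k)

*ₚ-assoc : ∀ p q r → ((p *ₚ q) *ₚ r) ≋ (p *ₚ (q *ₚ r))
*ₚ-assoc []      q r = ≋-refl
*ₚ-assoc (a ∷ p) q r =
  ≋-trans (*ₚ-distribʳ (map (a ℤ.*_) q) (0ℤ ∷ p *ₚ q) r)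
          (+ₚ-cong (scale-*ₚ a q r) (≋-trans (0∷-*ₚ (p *ₚ q) r) (∷-cong 0ℤ (*ₚ-assoc p q r))))

*ₚ-identityˡ : ∀ p → (oneP *ₚ p) ≋ p
*ₚ-identityˡ p = mk≋ (λ k → trans (coeff-+ₚ (map (1ℤ ℤ.*_) p) (0ℤ ∷ []) k)
                                   (trans (cong₂ ℤ._+_ (trans (coeff-scale 1ℤ p k) (ℤP.*-identityˡ _)) (zero-poly k)) (ℤP.+-identityʳ _)))
  where
  zero-poly : ∀ k → coeff (0ℤ ∷ []) k ≡ 0ℤ
  zero-poly zero    = refl
  zero-poly (suc k) = refl

*ₚ-identityʳ : ∀ p → (p *ₚ oneP) ≋ p
*ₚ-identityʳ p = ≋-trans (*ₚ-comm p oneP) (*ₚ-identityˡ p)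

*ₚ-exchange : ∀ p q r → (p *ₚ (q *ₚ r)) ≋ (q *ₚ (p *ₚ r))
*ₚ-exchange p q r = ≋-trans (≋-sym (*ₚ-assoc p q r)) (≋-trans (*ₚ-congʳ r (*ₚ-comm p q)) (*ₚ-assoc q p r))

*ₚ-cancelʳ : ∀ X → coeff X 0 ≡ 1ℤ → ∀ P R → (P *ₚ X) ≈ₚ (R *ₚ X) → P ≈ₚ R
*ₚ-cancelʳ X X₀≡1 P R PX≈RX zero = begin
    coeff P 0
  ≡⟨ sym (trans (cong (coeff P 0 ℤ.*_) X₀≡1) (ℤP.*-identityʳ _)) ⟩
    coeff P 0 ℤ.* coeff X 0
  ≡⟨ trans (sym (coeff-*ₚ-zero P X)) (trans (PX≈RX 0) (coeff-*ₚ-zero R X)) ⟩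
    coeff R 0 ℤ.* coeff X 0
  ≡⟨ trans (cong (coeff R 0 ℤ.*_) X₀≡1) (ℤP.*-identityʳ _) ⟩
    coeff R 0
  ∎
  where open ≡-Reasoning
*ₚ-cancelʳ X X₀≡1 P R PX≈RX (suc k) =
  trans (coeff-suc P k) (trans (*ₚ-cancelʳ X X₀≡1 (tailₚ P) (tailₚ R) tails k) (sym (coeff-suc R k)))
  where
  P₀≡R₀ : coeff P 0 ≡ coeff R 0
  P₀≡R₀ = *ₚ-cancelʳ X X₀≡1 P R PX≈RX 0
  tails : (tailₚ P *ₚ X) ≈ₚ (tailₚ R *ₚ X)
  tails j = ℤ+-cancelˡ (coeff P 0 ℤ.* coeff X (suc j)) _ _
              (trans (sym (coeff-*ₚ-suc P X j))
                     (trans (PX≈RX (suc j)) (trans (coeff-*ₚ-suc R X j) (cong (λ z → z ℤ.* coeff X (suc j) ℤ.+ _) (sym P₀≡R₀)))))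

evalP-+ₚ : ∀ p q t → evalP (p +ₚ q) t ≡ evalP p t ℤ.+ evalP q t
evalP-+ₚ []      q       t = sym (ℤP.+-identityˡ _)
evalP-+ₚ (a ∷ p) []      t = sym (ℤP.+-identityʳ _)
evalP-+ₚ (a ∷ p) (b ∷ q) t rewrite evalP-+ₚ p q t = rearrange a b t (evalP p t) (evalP q t)
  where
  rearrange : ∀ a b t x y → a ℤ.+ b ℤ.+ t ℤ.* (x ℤ.+ y) ≡ a ℤ.+ t ℤ.* x ℤ.+ (b ℤ.+ t ℤ.* y)
  rearrange = solve-∀

evalP-scale : ∀ a q t → evalP (map (a ℤ.*_) q) t ≡ a ℤ.* evalP q t
evalP-scale a []      t = sym (ℤP.*-zeroʳ a)
evalP-scale a (b ∷ q) t rewrite evalP-scale a q t = rearrange a b t (evalP q t)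
  where
  rearrange : ∀ a b t x → a ℤ.* b ℤ.+ t ℤ.* (a ℤ.* x) ≡ a ℤ.* (b ℤ.+ t ℤ.* x)
  rearrange = solve-∀

evalP-*ₚ : ∀ p q t → evalP (p *ₚ q) t ≡ evalP p t ℤ.* evalP q t
evalP-*ₚ []      q t = sym (ℤP.*-zeroˡ (evalP q t))
evalP-*ₚ (a ∷ p) q t =
  trans (evalP-+ₚ (map (a ℤ.*_) q) (0ℤ ∷ p *ₚ q) t)
        (trans (cong₂ ℤ._+_ (evalP-scale a q t) (cong (λ z → 0ℤ ℤ.+ t ℤ.* z) (evalP-*ₚ p q t)))
               (rearrange a t (evalP p t) (evalP q t)))
  where
  rearrange : ∀ a t x y → a ℤ.* y ℤ.+ (0ℤ ℤ.+ t ℤ.* (x ℤ.* y)) ≡ (a ℤ.+ t ℤ.* x) ℤ.* y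
  rearrange = solve-∀

evalP-≈ₚ : ∀ p q t → p ≈ₚ q → evalP p t ≡ evalP q t
evalP-≈ₚ []      []      t e = refl
evalP-≈ₚ []      (b ∷ q) t e = sym (evalP-zero (b ∷ q) (λ k → sym (e k)))
  where
  evalP-zero : ∀ p → p ≈ₚ [] → evalP p t ≡ 0ℤ
  evalP-zero []      e = refl
  evalP-zero (a ∷ p) e rewrite e 0 | evalP-zero p (λ k → e (suc k)) = trans (ℤP.+-identityˡ _) (ℤP.*-zeroʳ t)
evalP-≈ₚ (a ∷ p) []      t e = sym (evalP-≈ₚ [] (a ∷ p) t (λ k → sym (e k)))
evalP-≈ₚ (a ∷ p) (b ∷ q) t e = cong₂ (λ x y → x ℤ.+ t ℤ.* y) (e 0) (evalP-≈ₚ p q t (λ k → e (suc k)))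

evalP-qInt-1 : ∀ k → evalP (qInt k) 1ℤ ≡ + k
evalP-qInt-1 zero    = refl
evalP-qInt-1 (suc k) = trans (cong (λ z → 1ℤ ℤ.+ 1ℤ ℤ.* z) (evalP-qInt-1 k)) (cong (ℤ._+_ 1ℤ) (ℤP.*-identityˡ (+ k)))

evalP-qFact-1 : ∀ k → evalP (qFact k) 1ℤ ≡ + (k !)
evalP-qFact-1 zero    = refl
evalP-qFact-1 (suc k) =
  trans (evalP-*ₚ (qInt (suc k)) (qFact k) 1ℤ)
        (trans (cong₂ ℤ._*_ (evalP-qInt-1 (suc k)) (evalP-qFact-1 k)) (sym (ℤP.pos-* (suc k) (k !))))

qFact-constant : ∀ k → coeff (qFact k) 0 ≡ 1ℤ
qFact-constant zero    = refl
qFact-constant (suc k) = trans (coeff-*ₚ-zero (qInt (suc k)) (qFact k)) (cong (1ℤ ℤ.*_) (qFact-constant k))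

shiftₚ : ℕ → Poly → Poly
shiftₚ zero    p = p
shiftₚ (suc k) p = 0ℤ ∷ shiftₚ k p

shiftₚ-cong : ∀ k {p q} → p ≋ q → shiftₚ k p ≋ shiftₚ k q
shiftₚ-cong zero    e = e
shiftₚ-cong (suc k) e = ∷-cong 0ℤ (shiftₚ-cong k e)

shiftₚ-*ₚ : ∀ k p q → (shiftₚ k p *ₚ q) ≋ shiftₚ k (p *ₚ q)
shiftₚ-*ₚ zero    p q = ≋-refl
shiftₚ-*ₚ (suc k) p q = ≋-trans (0∷-*ₚ (shiftₚ k p) q) (∷-cong 0ℤ (shiftₚ-*ₚ k p q))

evalP-shiftₚ : ∀ k p t → evalP (shiftₚ k p) t ≡ t ℤ.^ k ℤ.* evalP p t
evalP-shiftₚ zero    p t = sym (ℤP.*-identityˡ _)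
evalP-shiftₚ (suc k) p t rewrite evalP-shiftₚ k p t = rearrange t (t ℤ.^ k) (evalP p t)
  where
  rearrange : ∀ t u x → 0ℤ ℤ.+ t ℤ.* (u ℤ.* x) ≡ t ℤ.* u ℤ.* x
  rearrange = solve-∀

qInt-+ : ∀ a b → (qInt a +ₚ shiftₚ a (qInt b)) ≋ qInt (a ℕ.+ b)
qInt-+ zero    b = ≋-refl
qInt-+ (suc a) b = ∷-cong 1ℤ (qInt-+ a b)

-- qBinomial a b is the Gaussian binomial coefficient [a + b choose a], by the q-Pascal rule.
qBinomial : ℕ → ℕ → Poly
qBinomial zero    b       = oneP
qBinomial (suc a) zero    = oneP
qBinomial (suc a) (suc b) = qBinomial a (suc b) +ₚ shiftₚ (suc a) (qBinomial (suc a) b)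

qBinomial-zeroʳ : ∀ a → qBinomial a zero ≡ oneP
qBinomial-zeroʳ zero    = refl
qBinomial-zeroʳ (suc a) = refl

evalP-qBinomial-suc : ∀ a b t → evalP (qBinomial (suc a) (suc b)) t
                              ≡ evalP (qBinomial a (suc b)) t ℤ.+ t ℤ.^ suc a ℤ.* evalP (qBinomial (suc a) b) t
evalP-qBinomial-suc a b t =
  trans (evalP-+ₚ (qBinomial a (suc b)) (shiftₚ (suc a) (qBinomial (suc a) b)) t)
        (cong (ℤ._+_ (evalP (qBinomial a (suc b)) t)) (evalP-shiftₚ (suc a) (qBinomial (suc a) b) t))

qBinomial-qFact : ∀ a b → (qBinomial a b *ₚ (qFact a *ₚ qFact b)) ≋ qFact (a ℕ.+ b)
qBinomial-qFact zero    b = ≋-trans (*ₚ-identityˡ _) (*ₚ-identityˡ (qFact b))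
qBinomial-qFact (suc a) zero
  rewrite ℕP.+-identityʳ a = ≋-trans (*ₚ-identityˡ _) (*ₚ-identityʳ (qFact (suc a)))
qBinomial-qFact (suc a) (suc b) = begin
    (qBinomial a (suc b) +ₚ shiftₚ (suc a) (qBinomial (suc a) b)) *ₚ (qFact (suc a) *ₚ qFact (suc b))
  ≈⟨ *ₚ-distribʳ (qBinomial a (suc b)) (shiftₚ (suc a) (qBinomial (suc a) b)) _ ⟩
    (qBinomial a (suc b) *ₚ ((qInt (suc a) *ₚ qFact a) *ₚ qFact (suc b)))
      +ₚ (shiftₚ (suc a) (qBinomial (suc a) b) *ₚ (qFact (suc a) *ₚ (qInt (suc b) *ₚ qFact b)))
  ≈⟨ +ₚ-cong left right ⟩
    (qInt (suc a) *ₚ qFact N) +ₚ (shiftₚ (suc a) (qInt (suc b)) *ₚ qFact N)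
  ≈⟨ ≋-sym (*ₚ-distribʳ (qInt (suc a)) (shiftₚ (suc a) (qInt (suc b))) (qFact N)) ⟩
    (qInt (suc a) +ₚ shiftₚ (suc a) (qInt (suc b))) *ₚ qFact N
  ≈⟨ *ₚ-congʳ (qFact N) (qInt-+ (suc a) (suc b)) ⟩
    qFact (suc a ℕ.+ suc b)
  ∎
  where
  open ≋-Reasoning
  N = a ℕ.+ suc b
  left : (qBinomial a (suc b) *ₚ ((qInt (suc a) *ₚ qFact a) *ₚ qFact (suc b))) ≋ (qInt (suc a) *ₚ qFact N)
  left = begin
      qBinomial a (suc b) *ₚ ((qInt (suc a) *ₚ qFact a) *ₚ qFact (suc b))
    ≈⟨ *ₚ-congˡ (qBinomial a (suc b)) (*ₚ-assoc (qInt (suc a)) (qFact a) (qFact (suc b))) ⟩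
      qBinomial a (suc b) *ₚ (qInt (suc a) *ₚ (qFact a *ₚ qFact (suc b)))
    ≈⟨ *ₚ-exchange (qBinomial a (suc b)) (qInt (suc a)) _ ⟩
      qInt (suc a) *ₚ (qBinomial a (suc b) *ₚ (qFact a *ₚ qFact (suc b)))
    ≈⟨ *ₚ-congˡ (qInt (suc a)) (qBinomial-qFact a (suc b)) ⟩
      qInt (suc a) *ₚ qFact N
    ∎
  right : (shiftₚ (suc a) (qBinomial (suc a) b) *ₚ (qFact (suc a) *ₚ (qInt (suc b) *ₚ qFact b)))
        ≋ (shiftₚ (suc a) (qInt (suc b)) *ₚ qFact N)
  right = begin
      shiftₚ (suc a) (qBinomial (suc a) b) *ₚ (qFact (suc a) *ₚ (qInt (suc b) *ₚ qFact b))
    ≈⟨ shiftₚ-*ₚ (suc a) (qBinomial (suc a) b) _ ⟩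
      shiftₚ (suc a) (qBinomial (suc a) b *ₚ (qFact (suc a) *ₚ (qInt (suc b) *ₚ qFact b)))
    ≈⟨ shiftₚ-cong (suc a) (≋-trans (*ₚ-congˡ (qBinomial (suc a) b) (*ₚ-exchange (qFact (suc a)) (qInt (suc b)) (qFact b)))
                                    (*ₚ-exchange (qBinomial (suc a) b) (qInt (suc b)) _)) ⟩
      shiftₚ (suc a) (qInt (suc b) *ₚ (qBinomial (suc a) b *ₚ (qFact (suc a) *ₚ qFact b)))
    ≈⟨ shiftₚ-cong (suc a) (*ₚ-congˡ (qInt (suc b)) (subst (λ k → (qBinomial (suc a) b *ₚ (qFact (suc a) *ₚ qFact b)) ≋ qFact k)
                                                           (sym (ℕP.+-suc a b)) (qBinomial-qFact (suc a) b))) ⟩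
      shiftₚ (suc a) (qInt (suc b) *ₚ qFact N)
    ≈⟨ ≋-sym (shiftₚ-*ₚ (suc a) (qInt (suc b)) (qFact N)) ⟩
      shiftₚ (suc a) (qInt (suc b)) *ₚ qFact N
    ∎

-- qMultinomial Gs is the Gaussian multinomial coefficient of the sizes of Gs, as a product of binomials.
qMultinomial : List (Σ ℕ Graph) → Poly
qMultinomial []             = oneP
qMultinomial ((n , G) ∷ Gs) = qBinomial n (totalSize Gs) *ₚ qMultinomial Gs

qFacts : List (Σ ℕ Graph) → Poly
qFacts Gs = productP (map (λ p → qFact (proj₁ p)) Gs)

qMultinomial-qFacts : ∀ Gs → (qMultinomial Gs *ₚ qFacts Gs) ≋ qFact (totalSize Gs)
qMultinomial-qFacts []             = *ₚ-identityˡ oneP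
qMultinomial-qFacts ((n , G) ∷ Gs) = begin
    (qBinomial n (totalSize Gs) *ₚ qMultinomial Gs) *ₚ (qFact n *ₚ qFacts Gs)
  ≈⟨ *ₚ-assoc (qBinomial n (totalSize Gs)) (qMultinomial Gs) _ ⟩
    qBinomial n (totalSize Gs) *ₚ (qMultinomial Gs *ₚ (qFact n *ₚ qFacts Gs))
  ≈⟨ *ₚ-congˡ (qBinomial n (totalSize Gs)) (*ₚ-exchange (qMultinomial Gs) (qFact n) (qFacts Gs)) ⟩
    qBinomial n (totalSize Gs) *ₚ (qFact n *ₚ (qMultinomial Gs *ₚ qFacts Gs))
  ≈⟨ *ₚ-congˡ (qBinomial n (totalSize Gs)) (*ₚ-congˡ (qFact n) (qMultinomial-qFacts Gs)) ⟩
    qBinomial n (totalSize Gs) *ₚ (qFact n *ₚ qFact (totalSize Gs))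
  ≈⟨ qBinomial-qFact n (totalSize Gs) ⟩
    qFact (n ℕ.+ totalSize Gs)
  ∎
  where open ≋-Reasoning

qFacts-constant : ∀ Gs → coeff (qFacts Gs) 0 ≡ 1ℤ
qFacts-constant []             = refl
qFacts-constant ((n , G) ∷ Gs) =
  trans (coeff-*ₚ-zero (qFact n) (qFacts Gs)) (cong₂ ℤ._*_ (qFact-constant n) (qFacts-constant Gs))

qMultinomial-unique : ∀ Gs P → (P *ₚ qFacts Gs) ≈ₚ qFact (totalSize Gs) → P ≈ₚ qMultinomial Gs
qMultinomial-unique Gs P spec =
  *ₚ-cancelʳ (qFacts Gs) (qFacts-constant Gs) P (qMultinomial Gs) (λ k → trans (spec k) (sym (coeffs (qMultinomial-qFacts Gs) k)))

-- Disjoint unions and joins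

-- The Gaussian coefficients count the disjoint union at t = 1 and the join at t = -1.
weight : Bool → ℤ
weight false = 1ℤ
weight true  = -1ℤ

-- the number of neighbours, in the first graph (of size a), of a vertex of the second
crossDegree : Bool → ℕ → ℕ
crossDegree false a = 0
crossDegree true  a = a

sgn-crossDegree : ∀ c a → sgn (crossDegree c a) ≡ weight c ℤ.^ a
sgn-crossDegree false a = sym (ℤP.^-zeroˡ a)
sgn-crossDegree true  a = refl

splitAt-punchIn-first : ∀ a b (w : Fin (suc a)) (x : Fin (a ℕ.+ b)) →
  splitAt (suc a) (punchIn (w ↑ˡ b) x) ≡ Data.Sum.map (punchIn w) (λ y → y) (splitAt a x)
splitAt-punchIn-first a       b Fin.zero    x           = refl
splitAt-punchIn-first (suc a) b (Fin.suc w) Fin.zero    = refl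
splitAt-punchIn-first (suc a) b (Fin.suc w) (Fin.suc x) rewrite splitAt-punchIn-first a b w x with splitAt a x
... | inj₁ _ = refl
... | inj₂ _ = refl

splitAt-punchIn-second : ∀ a b (w : Fin (suc b)) (x : Fin (a ℕ.+ suc b)) (eq : a ℕ.+ suc b ≡ suc (a ℕ.+ b)) →
  splitAt (suc a) (punchIn (suc a ↑ʳ w) x) ≡ Data.Sum.map (λ y → y) (punchIn w) (splitAt (suc a) (Fin.cast eq x))
splitAt-punchIn-second zero    b w Fin.zero    eq = refl
splitAt-punchIn-second zero    b w (Fin.suc x) eq = cong (λ z → inj₂ (punchIn w z)) (sym (FinP.cast-is-id _ x))
splitAt-punchIn-second (suc a) b w Fin.zero    eq = refl
splitAt-punchIn-second (suc a) b w (Fin.suc x) eq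
  rewrite splitAt-punchIn-second a b w x (cong ℕ.pred eq) with splitAt (suc a) (Fin.cast (cong ℕ.pred eq) x)
... | inj₁ _ = refl
... | inj₂ _ = refl

A₋₁-deleteV-first : ∀ {a b} c (G : Graph (suc a)) (H : Graph b) w →
  A₋₁ (deleteV (combine2 c G H) (w ↑ˡ b)) ≡ A₋₁ (combine2 c (deleteV G w) H)
A₋₁-deleteV-first {a} {b} c G H w =
  A₋₁-cong (deleteV (combine2 c G H) (w ↑ˡ b)) (combine2 c (deleteV G w) H) (λ x y → trans (cong₂ (twoAdj c G H) (splitAt-punchIn-first a b w x) (splitAt-punchIn-first a b w y))
                             (adj-map (splitAt a x) (splitAt a y)))
  where
  adj-map : ∀ s t → twoAdj c G H (Data.Sum.map (punchIn w) (λ y → y) s) (Data.Sum.map (punchIn w) (λ y → y) t)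
                  ≡ twoAdj c (deleteV G w) H s t
  adj-map (inj₁ x) (inj₁ y) = refl
  adj-map (inj₁ x) (inj₂ y) = refl
  adj-map (inj₂ x) (inj₁ y) = refl
  adj-map (inj₂ x) (inj₂ y) = refl

A₋₁-deleteV-second : ∀ {a b} c (G : Graph (suc a)) (H : Graph (suc b)) w →
  A₋₁ (deleteV (combine2 c G H) (suc a ↑ʳ w)) ≡ A₋₁ (combine2 c G (deleteV H w))
A₋₁-deleteV-second {a} {b} c G H w =
  A₋₁-cast eq (deleteV (combine2 c G H) (suc a ↑ʳ w)) (combine2 c G (deleteV H w)) (λ x y → sym (trans (cong₂ (twoAdj c G H) (splitAt-punchIn-second a b w x eq) (splitAt-punchIn-second a b w y eq))
                                       (adj-map (splitAt (suc a) (Fin.cast eq x)) (splitAt (suc a) (Fin.cast eq y)))))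
  where
  eq = ℕP.+-suc a b
  adj-map : ∀ s t → twoAdj c G H (Data.Sum.map (λ y → y) (punchIn w) s) (Data.Sum.map (λ y → y) (punchIn w) t)
                  ≡ twoAdj c G (deleteV H w) s t
  adj-map (inj₁ x) (inj₁ y) = refl
  adj-map (inj₁ x) (inj₂ y) = refl
  adj-map (inj₂ x) (inj₁ y) = refl
  adj-map (inj₂ x) (inj₂ y) = refl

+-<ᵇ-+ : ∀ a x y → (a ℕ.+ x <ᵇ a ℕ.+ y) ≡ (x <ᵇ y)
+-<ᵇ-+ zero    x y = refl
+-<ᵇ-+ (suc a) x y = +-<ᵇ-+ a x y

lowerDegree-first : ∀ {a b} c (G : Graph a) (H : Graph b) w → lowerDegree (combine2 c G H) (w ↑ˡ b) ≡ lowerDegree G w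
lowerDegree-first {a} {b} c G H w = ℤP.+-injective (begin
    + lowerDegree (combine2 c G H) (w ↑ˡ b)
  ≡⟨ trans (lowerDegree-ℤ (combine2 c G H) (w ↑ˡ b)) (∑-↑ a b (λ u → 𝟙 (orient (combine2 c G H) u (w ↑ˡ b)))) ⟩
    ∑[ u < a ] 𝟙 (orient (combine2 c G H) (u ↑ˡ b) (w ↑ˡ b)) ℤ.+ ∑[ u < b ] 𝟙 (orient (combine2 c G H) (a ↑ʳ u) (w ↑ˡ b))
  ≡⟨ cong₂ ℤ._+_ (∑-cong a inside) (trans (∑-cong b later) (∑-zero b)) ⟩
    ∑[ u < a ] 𝟙 (orient G u w) ℤ.+ 0ℤ
  ≡⟨ trans (ℤP.+-identityʳ _) (sym (lowerDegree-ℤ G w)) ⟩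
    + lowerDegree G w
  ∎)
  where
  open ≡-Reasoning
  inside : ∀ u → 𝟙 (orient (combine2 c G H) (u ↑ˡ b) (w ↑ˡ b)) ≡ 𝟙 (orient G u w)
  inside u rewrite FinP.splitAt-↑ˡ a u b | FinP.splitAt-↑ˡ a w b | FinP.toℕ-↑ˡ u b | FinP.toℕ-↑ˡ w b = refl
  later : ∀ u → 𝟙 (orient (combine2 c G H) (a ↑ʳ u) (w ↑ˡ b)) ≡ 0ℤ
  later u rewrite FinP.splitAt-↑ʳ a b u | FinP.splitAt-↑ˡ a w b | FinP.toℕ-↑ʳ a u | FinP.toℕ-↑ˡ w b
                | ≤⇒<ᵇ-false {toℕ w} {a ℕ.+ toℕ u} (ℕP.≤-trans (ℕP.<⇒≤ (FinP.toℕ<n w)) (ℕP.m≤m+n a (toℕ u))) = cong 𝟙 (∧-zeroʳ c)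

lowerDegree-second : ∀ {a b} c (G : Graph a) (H : Graph b) w →
  lowerDegree (combine2 c G H) (a ↑ʳ w) ≡ crossDegree c a ℕ.+ lowerDegree H w
lowerDegree-second {a} {b} c G H w = ℤP.+-injective (begin
    + lowerDegree (combine2 c G H) (a ↑ʳ w)
  ≡⟨ trans (lowerDegree-ℤ (combine2 c G H) (a ↑ʳ w)) (∑-↑ a b (λ u → 𝟙 (orient (combine2 c G H) u (a ↑ʳ w)))) ⟩
    ∑[ u < a ] 𝟙 (orient (combine2 c G H) (u ↑ˡ b) (a ↑ʳ w)) ℤ.+ ∑[ u < b ] 𝟙 (orient (combine2 c G H) (a ↑ʳ u) (a ↑ʳ w))
  ≡⟨ cong₂ ℤ._+_ (trans (∑-cong a earlier) (trans (∑-const a (𝟙 c)) (cross c))) (trans (∑-cong b inside) (sym (lowerDegree-ℤ H w))) ⟩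
    + crossDegree c a ℤ.+ + lowerDegree H w
  ≡⟨ sym (ℤP.pos-+ (crossDegree c a) (lowerDegree H w)) ⟩
    + (crossDegree c a ℕ.+ lowerDegree H w)
  ∎)
  where
  open ≡-Reasoning
  earlier : ∀ u → 𝟙 (orient (combine2 c G H) (u ↑ˡ b) (a ↑ʳ w)) ≡ 𝟙 c
  earlier u rewrite FinP.splitAt-↑ˡ a u b | FinP.splitAt-↑ʳ a b w | FinP.toℕ-↑ˡ u b | FinP.toℕ-↑ʳ a w
                  | <⇒<ᵇ {toℕ u} {a ℕ.+ toℕ w} (ℕP.≤-trans (FinP.toℕ<n u) (ℕP.m≤m+n a (toℕ w))) = cong 𝟙 (∧-identityʳ c)
  inside : ∀ u → 𝟙 (orient (combine2 c G H) (a ↑ʳ u) (a ↑ʳ w)) ≡ 𝟙 (orient H u w)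
  inside u rewrite FinP.splitAt-↑ʳ a b u | FinP.splitAt-↑ʳ a b w | FinP.toℕ-↑ʳ a u | FinP.toℕ-↑ʳ a w | +-<ᵇ-+ a (toℕ u) (toℕ w) = refl
  cross : ∀ c → + a ℤ.* 𝟙 c ≡ + crossDegree c a
  cross true  = ℤP.*-identityʳ (+ a)
  cross false = ℤP.*-zeroʳ (+ a)

-- the terms of the vertex recursion of combine2 c G H that delete a vertex of H
secondTerms : ∀ {a} b → Bool → Graph a → Graph b → ℤ
secondTerms zero        c G H = 0ℤ
secondTerms {a} (suc b) c G H =
  ∑[ w < suc b ] (sgn (crossDegree c a ℕ.+ lowerDegree H w) ℤ.* A₋₁ (combine2 c G (deleteV H w)))

A₋₁-combine2-deleteV : ∀ {a b} c (G : Graph (suc a)) (H : Graph b) →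
  A₋₁ (combine2 c G H) ≡ ∑[ w < suc a ] (sgn (lowerDegree G w) ℤ.* A₋₁ (combine2 c (deleteV G w) H)) ℤ.+ secondTerms b c G H
A₋₁-combine2-deleteV {a} {b} c G H =
  trans (A₋₁-deleteV (combine2 c G H))
        (trans (∑-↑ (suc a) b (λ p → sgn (lowerDegree (combine2 c G H) p) ℤ.* A₋₁ (deleteV (combine2 c G H) p))) (cong₂ ℤ._+_ (∑-cong (suc a) first) (second b H)))
  where
  first : ∀ w → sgn (lowerDegree (combine2 c G H) (w ↑ˡ b)) ℤ.* A₋₁ (deleteV (combine2 c G H) (w ↑ˡ b))
              ≡ sgn (lowerDegree G w) ℤ.* A₋₁ (combine2 c (deleteV G w) H)
  first w = cong₂ ℤ._*_ (cong sgn (lowerDegree-first c G H w)) (A₋₁-deleteV-first c G H w)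
  second : ∀ b (H : Graph b) →
    ∑[ w < b ] (sgn (lowerDegree (combine2 c G H) (suc a ↑ʳ w)) ℤ.* A₋₁ (deleteV (combine2 c G H) (suc a ↑ʳ w))) ≡ secondTerms b c G H
  second zero    H = refl
  second (suc b) H = ∑-cong (suc b) (λ w → cong₂ ℤ._*_ (cong sgn (lowerDegree-second c G H w)) (A₋₁-deleteV-second c G H w))

-- The vertex recursion, read backwards.
∑-A₋₁-deleteV : ∀ {n} (G : Graph (suc n)) K (g : Fin (suc n) → ℤ) →
  (∀ w → g w ≡ K ℤ.* (sgn (lowerDegree G w) ℤ.* A₋₁ (deleteV G w))) → ∑[ w < suc n ] g w ≡ K ℤ.* A₋₁ G
∑-A₋₁-deleteV {n} G K g g-spec =
  trans (∑-cong (suc n) g-spec) (trans (sym (*-distribˡ-sum K (λ w → sgn (lowerDegree G w) ℤ.* A₋₁ (deleteV G w)))) (cong (K ℤ.*_) (sym (A₋₁-deleteV G))))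

firstTerms-factor : ∀ {a b} c (G : Graph (suc a)) (H : Graph b) e →
  (∀ w → A₋₁ (combine2 c (deleteV G w) H) ≡ e ℤ.* (A₋₁ (deleteV G w) ℤ.* A₋₁ H)) →
  ∑[ w < suc a ] (sgn (lowerDegree G w) ℤ.* A₋₁ (combine2 c (deleteV G w) H)) ≡ (e ℤ.* A₋₁ H) ℤ.* A₋₁ G
firstTerms-factor c G H e smaller = ∑-A₋₁-deleteV G (e ℤ.* A₋₁ H) _ (λ w →
  trans (cong (sgn (lowerDegree G w) ℤ.*_) (smaller w)) (rearrange (sgn (lowerDegree G w)) e (A₋₁ (deleteV G w)) (A₋₁ H)))
  where
  rearrange : ∀ s e g h → s ℤ.* (e ℤ.* (g ℤ.* h)) ≡ (e ℤ.* h) ℤ.* (s ℤ.* g)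
  rearrange = solve-∀

secondTerms-factor : ∀ {a b} c (G : Graph a) (H : Graph (suc b)) e →
  (∀ w → A₋₁ (combine2 c G (deleteV H w)) ≡ e ℤ.* (A₋₁ G ℤ.* A₋₁ (deleteV H w))) →
  secondTerms (suc b) c G H ≡ (weight c ℤ.^ a ℤ.* e ℤ.* A₋₁ G) ℤ.* A₋₁ H
secondTerms-factor {a} c G H e smaller =
  ∑-A₋₁-deleteV H (weight c ℤ.^ a ℤ.* e ℤ.* A₋₁ G)
    (λ w → sgn (crossDegree c a ℕ.+ lowerDegree H w) ℤ.* A₋₁ (combine2 c G (deleteV H w))) (λ w →
    trans (cong₂ ℤ._*_ (trans (sgn-+ (crossDegree c a) (lowerDegree H w)) (cong (ℤ._* sgn (lowerDegree H w)) (sgn-crossDegree c a)))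
                       (smaller w))
          (rearrange (weight c ℤ.^ a) (sgn (lowerDegree H w)) e (A₋₁ G) (A₋₁ (deleteV H w))))
  where
  rearrange : ∀ x s e g h → (x ℤ.* s) ℤ.* (e ℤ.* (g ℤ.* h)) ≡ (x ℤ.* e ℤ.* g) ℤ.* (s ℤ.* h)
  rearrange = solve-∀

evalP-oneP : ∀ t → evalP oneP t ≡ 1ℤ
evalP-oneP t = trans (cong (ℤ._+_ 1ℤ) (ℤP.*-zeroʳ t)) (ℤP.+-identityʳ 1ℤ)

A₋₁-combine2 : ∀ c a b (G : Graph a) (H : Graph b) →
  A₋₁ (combine2 c G H) ≡ evalP (qBinomial a b) (weight c) ℤ.* (A₋₁ G ℤ.* A₋₁ H)
A₋₁-combine2 c zero    b G H = sym (trans (cong (ℤ._* (1ℤ ℤ.* A₋₁ H)) (evalP-oneP (weight c)))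
                                          (trans (ℤP.*-identityˡ _) (ℤP.*-identityˡ (A₋₁ H))))
A₋₁-combine2 c (suc a) b G H =
  trans (A₋₁-combine2-deleteV c G H)
        (trans (cong (ℤ._+ secondTerms b c G H) (firstTerms-factor c G H (E a b) (λ w → A₋₁-combine2 c a b (deleteV G w) H)))
               (add-second b H))
  where
  t = weight c
  E : ℕ → ℕ → ℤ
  E a b = evalP (qBinomial a b) t
  add-second : ∀ b (H : Graph b) → (E a b ℤ.* A₋₁ H) ℤ.* A₋₁ G ℤ.+ secondTerms b c G H ≡ E (suc a) b ℤ.* (A₋₁ G ℤ.* A₋₁ H)
  add-second zero    H rewrite qBinomial-zeroʳ a = trans (ℤP.+-identityʳ _) (rearrange (evalP oneP t) (A₋₁ G) (A₋₁ H))
    where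
    rearrange : ∀ e g h → (e ℤ.* h) ℤ.* g ≡ e ℤ.* (g ℤ.* h)
    rearrange = solve-∀
  add-second (suc b) H = begin
      (E a (suc b) ℤ.* A₋₁ H) ℤ.* A₋₁ G ℤ.+ secondTerms (suc b) c G H
    ≡⟨ cong (ℤ._+_ ((E a (suc b) ℤ.* A₋₁ H) ℤ.* A₋₁ G))
            (secondTerms-factor c G H (E (suc a) b) (λ w → A₋₁-combine2 c (suc a) b G (deleteV H w))) ⟩
      (E a (suc b) ℤ.* A₋₁ H) ℤ.* A₋₁ G ℤ.+ (t ℤ.^ suc a ℤ.* E (suc a) b ℤ.* A₋₁ G) ℤ.* A₋₁ H
    ≡⟨ rearrange (E a (suc b)) (t ℤ.^ suc a) (E (suc a) b) (A₋₁ G) (A₋₁ H) ⟩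
      (E a (suc b) ℤ.+ t ℤ.^ suc a ℤ.* E (suc a) b) ℤ.* (A₋₁ G ℤ.* A₋₁ H)
    ≡⟨ cong (ℤ._* (A₋₁ G ℤ.* A₋₁ H)) (sym (evalP-qBinomial-suc a b t)) ⟩
      E (suc a) (suc b) ℤ.* (A₋₁ G ℤ.* A₋₁ H)
    ∎
    where
    open ≡-Reasoning
    rearrange : ∀ e x e′ g h → (e ℤ.* h) ℤ.* g ℤ.+ (x ℤ.* e′ ℤ.* g) ℤ.* h ≡ (e ℤ.+ x ℤ.* e′) ℤ.* (g ℤ.* h)
    rearrange = solve-∀

∏A₋₁ : List (Σ ℕ Graph) → ℤ
∏A₋₁ []             = 1ℤ
∏A₋₁ ((n , G) ∷ Gs) = A₋₁ G ℤ.* ∏A₋₁ Gs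

∣∏A₋₁∣ : ∀ Gs → ∣ ∏A₋₁ Gs ∣ ≡ product (map (λ p → ν (proj₂ p)) Gs)
∣∏A₋₁∣ []             = refl
∣∏A₋₁∣ ((n , G) ∷ Gs) = trans (ℤP.abs-* (A₋₁ G) (∏A₋₁ Gs)) (cong (ν G ℕ.*_) (∣∏A₋₁∣ Gs))

A₋₁-combineAll : ∀ c Gs → A₋₁ (combineAll c Gs) ≡ evalP (qMultinomial Gs) (weight c) ℤ.* ∏A₋₁ Gs
A₋₁-combineAll c []             = sym (trans (ℤP.*-identityʳ _) (evalP-oneP (weight c)))
A₋₁-combineAll c ((n , G) ∷ Gs) =
  trans (A₋₁-combine2 c n (totalSize Gs) G (combineAll c Gs))
        (trans (cong (λ z → evalP (qBinomial n (totalSize Gs)) (weight c) ℤ.* (A₋₁ G ℤ.* z)) (A₋₁-combineAll c Gs))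
               (trans (rearrange (evalP (qBinomial n (totalSize Gs)) (weight c)) (A₋₁ G) (evalP (qMultinomial Gs) (weight c)) (∏A₋₁ Gs))
                      (cong (ℤ._* (A₋₁ G ℤ.* ∏A₋₁ Gs)) (sym (evalP-*ₚ (qBinomial n (totalSize Gs)) (qMultinomial Gs) (weight c))))))
  where
  rearrange : ∀ b g m p → b ℤ.* (g ℤ.* (m ℤ.* p)) ≡ (b ℤ.* m) ℤ.* (g ℤ.* p)
  rearrange = solve-∀

evalP-qFacts-1 : ∀ Gs → evalP (qFacts Gs) 1ℤ ≡ + product (map (λ p → proj₁ p !) Gs)
evalP-qFacts-1 []             = refl
evalP-qFacts-1 ((n , G) ∷ Gs) =
  trans (evalP-*ₚ (qFact n) (qFacts Gs) 1ℤ)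
        (trans (cong₂ ℤ._*_ (evalP-qFact-1 n) (evalP-qFacts-1 Gs)) (sym (ℤP.pos-* (n !) _)))

∏!≢0 : ∀ (Gs : List (Σ ℕ Graph)) → ℕ.NonZero (product (map (λ p → proj₁ p !) Gs))
∏!≢0 []             = _
∏!≢0 ((n , G) ∷ Gs) = ℕP.m*n≢0 (n !) _ {{ℕP._!≢0 n}} {{∏!≢0 Gs}}

∣qMultinomial-1∣ : ∀ Gs → ∣ evalP (qMultinomial Gs) 1ℤ ∣ * product (map (λ p → proj₁ p !) Gs) ≡ totalSize Gs !
∣qMultinomial-1∣ Gs = begin
    ∣ evalP (qMultinomial Gs) 1ℤ ∣ * product (map (λ p → proj₁ p !) Gs)
  ≡⟨ sym (ℤP.abs-* (evalP (qMultinomial Gs) 1ℤ) _) ⟩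
    ∣ evalP (qMultinomial Gs) 1ℤ ℤ.* + product (map (λ p → proj₁ p !) Gs) ∣
  ≡⟨ cong ∣_∣ (trans (cong (evalP (qMultinomial Gs) 1ℤ ℤ.*_) (sym (evalP-qFacts-1 Gs))) (sym (evalP-*ₚ (qMultinomial Gs) (qFacts Gs) 1ℤ))) ⟩
    ∣ evalP (qMultinomial Gs *ₚ qFacts Gs) 1ℤ ∣
  ≡⟨ cong ∣_∣ (trans (evalP-≈ₚ (qMultinomial Gs *ₚ qFacts Gs) (qFact (totalSize Gs)) 1ℤ (coeffs (qMultinomial-qFacts Gs))) (evalP-qFact-1 (totalSize Gs))) ⟩
    totalSize Gs !
  ∎
  where open ≡-Reasoning

ν-disjointUnion : ∀ (Gs : List (Σ ℕ Graph)) (M : ℕ) →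
  M * product (map (λ p → proj₁ p !) Gs) ≡ totalSize Gs ! →
  ν (disjointUnion Gs) ≡ M * product (map (λ p → ν (proj₂ p)) Gs)
ν-disjointUnion Gs M M-spec = begin
    ∣ A₋₁ (disjointUnion Gs) ∣
  ≡⟨ cong ∣_∣ (A₋₁-combineAll false Gs) ⟩
    ∣ evalP (qMultinomial Gs) 1ℤ ℤ.* ∏A₋₁ Gs ∣
  ≡⟨ ℤP.abs-* (evalP (qMultinomial Gs) 1ℤ) (∏A₋₁ Gs) ⟩
    ∣ evalP (qMultinomial Gs) 1ℤ ∣ * ∣ ∏A₋₁ Gs ∣
  ≡⟨ cong₂ _*_ (sym M≡) (∣∏A₋₁∣ Gs) ⟩
    M * product (map (λ p → ν (proj₂ p)) Gs)
  ∎
  where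
  open ≡-Reasoning
  M≡ : M ≡ ∣ evalP (qMultinomial Gs) 1ℤ ∣
  M≡ = ℕP.*-cancelʳ-≡ M _ (product (map (λ p → proj₁ p !) Gs)) {{∏!≢0 Gs}} (trans M-spec (sym (∣qMultinomial-1∣ Gs)))

ν-join : ∀ (Gs : List (Σ ℕ Graph)) (P : Poly) →
  (P *ₚ productP (map (λ p → qFact (proj₁ p)) Gs)) ≈ₚ qFact (totalSize Gs) →
  ν (join Gs) ≡ ∣ evalP P (- (+ 1)) ∣ * product (map (λ p → ν (proj₂ p)) Gs)
ν-join Gs P P-spec = begin
    ∣ A₋₁ (join Gs) ∣
  ≡⟨ cong ∣_∣ (A₋₁-combineAll true Gs) ⟩
    ∣ evalP (qMultinomial Gs) -1ℤ ℤ.* ∏A₋₁ Gs ∣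
  ≡⟨ ℤP.abs-* (evalP (qMultinomial Gs) -1ℤ) (∏A₋₁ Gs) ⟩
    ∣ evalP (qMultinomial Gs) -1ℤ ∣ * ∣ ∏A₋₁ Gs ∣
  ≡⟨ cong₂ _*_ (cong ∣_∣ (sym (evalP-≈ₚ P (qMultinomial Gs) -1ℤ (qMultinomial-unique Gs P P-spec)))) (∣∏A₋₁∣ Gs) ⟩
    ∣ evalP P -1ℤ ∣ * product (map (λ p → ν (proj₂ p)) Gs)
  ∎
  where open ≡-Reasoning

-- Rooted products

-- Any injective labelling f has the relative order of the bijection ρ ranking its labels.
module Rank {n m} (f : Fin n → Fin m) (f-inj : Injective _≡_ _≡_ f) where

  below : Fin n → Subset n
  below x = Vec.tabulate (λ z → toℕ (f z) <ᵇ toℕ (f x))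

  ∈-below : ∀ {x z} → toℕ (f z) ℕ.< toℕ (f x) → z ∈ below x
  ∈-below {x} {z} fz<fx = lookup⇒[]= z (below x) (trans (lookup∘tabulate _ z) (<⇒<ᵇ fz<fx))

  ∈-below⁻ : ∀ {x z} → z ∈ below x → toℕ (f z) ℕ.< toℕ (f x)
  ∈-below⁻ {x} {z} z∈ = <ᵇ⇒< (trans (sym (lookup∘tabulate _ z)) ([]=⇒lookup z∈))

  ∉-below-self : ∀ x → x ∉ below x
  ∉-below-self x x∈ = ℕP.<-irrefl refl (∈-below⁻ x∈)

  rank : Fin n → ℕ
  rank x = ∣ below x ∣ˢ

  rank<n : ∀ x → rank x ℕ.< n
  rank<n x = subst (rank x ℕ.<_) (∣⊤∣≡n n) (p⊂q⇒∣p∣<∣q∣ ((λ _ → ∈⊤) , (x , ∈⊤ , ∉-below-self x)))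

  rank-mono : ∀ a b → toℕ (f a) ℕ.< toℕ (f b) → rank a ℕ.< rank b
  rank-mono a b fa<fb = p⊂q⇒∣p∣<∣q∣ ((λ z∈ → ∈-below (ℕP.<-trans (∈-below⁻ z∈) fa<fb)) , (a , ∈-below fa<fb , ∉-below-self a))

  ρ : Fin n → Fin n
  ρ x = fromℕ< (rank<n x)

  toℕ-ρ : ∀ x → toℕ (ρ x) ≡ rank x
  toℕ-ρ x = FinP.toℕ-fromℕ< (rank<n x)

  ρ-order : ∀ a b → (toℕ (f a) <ᵇ toℕ (f b)) ≡ (toℕ (ρ a) <ᵇ toℕ (ρ b))
  ρ-order a b rewrite toℕ-ρ a | toℕ-ρ b with ℕP.<-cmp (toℕ (f a)) (toℕ (f b))
  ... | tri< fa<fb _ _ = trans (<⇒<ᵇ fa<fb) (sym (<⇒<ᵇ (rank-mono a b fa<fb)))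
  ... | tri≈ _ fa≡fb _ rewrite f-inj (FinP.toℕ-injective fa≡fb) =
    trans (≤⇒<ᵇ-false (ℕP.≤-refl {toℕ (f b)})) (sym (≤⇒<ᵇ-false (ℕP.≤-refl {rank b})))
  ... | tri> _ _ fb<fa = trans (≤⇒<ᵇ-false (ℕP.<⇒≤ fb<fa)) (sym (≤⇒<ᵇ-false (ℕP.<⇒≤ (rank-mono b a fb<fa))))

  ρ-injective : Injective _≡_ _≡_ ρ
  ρ-injective {a} {b} e with ℕP.<-cmp (toℕ (f a)) (toℕ (f b))
  ... | tri< fa<fb _ _ = ⊥-elim (ℕP.<-irrefl (trans (sym (toℕ-ρ a)) (trans (cong toℕ e) (toℕ-ρ b))) (rank-mono a b fa<fb))
  ... | tri≈ _ fa≡fb _ = f-inj (FinP.toℕ-injective fa≡fb)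
  ... | tri> _ _ fb<fa = ⊥-elim (ℕP.<-irrefl (trans (sym (toℕ-ρ b)) (trans (cong toℕ (sym e)) (toℕ-ρ a))) (rank-mono b a fb<fa))

∑-bij-desAlong : ∀ {n m} (D : Digraph n) (f : Fin n → Fin m) → Injective _≡_ _≡_ f →
  ∑[ α ∈ bijections n ] sgn (desAlong D (λ x → f (α x))) ≡ ∑[ α ∈ bijections n ] sgn (des D α)
∑-bij-desAlong {n} D f f-inj =
  trans (∑ˡ-cong (bijections n) (λ α → cong sgn (trans (desAlong-order D (λ x → f (α x)) (λ x → ρ (α x)) (λ a b → ρ-order (α a) (α b)))
                                                         (sym (des≡desAlong D (λ x → ρ (α x)))))))
        (sym (∑-bij-∘ˡ n ρ ρ-injective (λ σ → sgn (des D σ)) (sgn-des-respects D)))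
  where open Rank f f-inj

edgeless : ∀ n → Graph n
edgeless n = record { adj = λ _ _ → false ; adj-sym = λ _ _ → refl ; irrefl = λ _ → refl }

∑∑-combine : ∀ n₁ n₂ (H : Fin (n₁ * n₂) → Fin (n₁ * n₂) → ℤ) →
  ∑[ p < n₁ * n₂ ] ∑[ q < n₁ * n₂ ] H p q ≡ ∑[ x < n₁ ] ∑[ y < n₂ ] ∑[ x′ < n₁ ] ∑[ y′ < n₂ ] H (combine x y) (combine x′ y′)
∑∑-combine n₁ n₂ H =
  trans (∑-combine n₁ n₂ (λ p → ∑[ q < n₁ * n₂ ] H p q))
        (∑-cong n₁ (λ x → ∑-cong n₂ (λ y → ∑-combine n₁ n₂ (H (combine x y)))))

𝟙-∨-disjoint : ∀ b c d e → (b ≡ true → c ≡ false) → 𝟙 (((b ∨ c) ∧ d) ∧ e) ≡ 𝟙 ((b ∧ d) ∧ e) ℤ.+ 𝟙 ((c ∧ d) ∧ e)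
𝟙-∨-disjoint true  c d e b⇒¬c rewrite b⇒¬c refl with d ∧ e
... | true  = refl
... | false = refl
𝟙-∨-disjoint false true  true  true  _ = refl
𝟙-∨-disjoint false true  true  false _ = refl
𝟙-∨-disjoint false true  false e     _ = refl
𝟙-∨-disjoint false false d     e     _ = refl

module RootedProduct {n₁ n₂ : ℕ} (G₁ : Graph n₁) (G₂ : Graph n₂) (v : Fin n₂) where

  N : ℕ
  N = n₁ * n₂

  -- n₁ disjoint copies of G₂
  copies : Graph N
  copies = rootedProduct (edgeless n₁) G₂ v

  root : Fin n₁ → Fin N
  root x = combine x v

  root-injective : Injective _≡_ _≡_ root
  root-injective {x} {x′} e =
    cong proj₁ (trans (sym (FinP.remQuot-combine x v)) (trans (cong (remQuot {n₁} n₂) e) (FinP.remQuot-combine x′ v)))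

  combine-<ᵇ-copy : ∀ x y y′ → (toℕ (combine {n₁} {n₂} x y) <ᵇ toℕ (combine {n₁} {n₂} x y′)) ≡ (toℕ y <ᵇ toℕ y′)
  combine-<ᵇ-copy x y y′ rewrite FinP.toℕ-combine x y | FinP.toℕ-combine x y′ = +-<ᵇ-+ (n₂ * toℕ x) (toℕ y) (toℕ y′)

  combine-<ᵇ-root : ∀ x x′ → (toℕ (root x) <ᵇ toℕ (root x′)) ≡ (toℕ x <ᵇ toℕ x′)
  combine-<ᵇ-root x x′ rewrite FinP.toℕ-combine x v | FinP.toℕ-combine x′ v = scaled n₂ v
    where
    scaled : ∀ k (t : Fin k) → (k * toℕ x ℕ.+ toℕ t <ᵇ k * toℕ x′ ℕ.+ toℕ t) ≡ (toℕ x <ᵇ toℕ x′)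
    scaled (suc k) t = bool-ext
      (λ e → <⇒<ᵇ (ℕP.*-cancelˡ-< (suc k) (toℕ x) (toℕ x′) (ℕP.+-cancelʳ-< (toℕ t) (suc k * toℕ x) (suc k * toℕ x′) (<ᵇ⇒< e))))
      (λ e → <⇒<ᵇ (ℕP.+-monoˡ-< (toℕ t) (ℕP.*-monoʳ-< (suc k) (<ᵇ⇒< {toℕ x} {toℕ x′} e))))

  copyEdge rootEdge : Fin n₁ × Fin n₂ → Fin n₁ × Fin n₂ → Bool
  copyEdge (x , y) (x′ , y′) = (x ≟ᵇ x′) ∧ adj G₂ y y′
  rootEdge (x , y) (x′ , y′) = ((y ≟ᵇ v) ∧ (y′ ≟ᵇ v)) ∧ adj G₁ x x′

  copyEdge⇒¬rootEdge : ∀ s t → copyEdge s t ≡ true → rootEdge s t ≡ false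
  copyEdge⇒¬rootEdge (x , y) (x′ , y′) e with rootEdge (x , y) (x′ , y′) in root-e
  ... | false = refl
  ... | true  = ⊥-elim (case (trans (sym (irrefl G₁ x)) (trans (cong (adj G₁ x) (≟ᵇ⇒≡ (proj₁ (∧-true⁻ e)))) (proj₂ (∧-true⁻ root-e)))))
    where
    case : false ≡ true → ⊥
    case ()

  pairAdj-edgeless : ∀ s t → pairAdj (edgeless n₁) G₂ v s t ≡ copyEdge s t
  pairAdj-edgeless (x , y) (x′ , y′) rewrite ∧-zeroʳ ((y ≟ᵇ v) ∧ (y′ ≟ᵇ v)) = ∨-identityʳ _

  descent : (Fin N → Fin N) → Fin N → Fin N → Bool
  descent σ p q = (toℕ p <ᵇ toℕ q) ∧ (toℕ (σ q) <ᵇ toℕ (σ p))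

  rootDescents : (Fin N → Fin N) → ℤ
  rootDescents σ = ∑[ p < N ] ∑[ q < N ] 𝟙 ((rootEdge (remQuot {n₁} n₂ p) (remQuot {n₁} n₂ q) ∧ (toℕ p <ᵇ toℕ q)) ∧ (toℕ (σ q) <ᵇ toℕ (σ p)))

  -- Only the roots carry edges of G₁, and they are ordered as V(G₁).
  rootDescents-desAlong : ∀ σ → rootDescents σ ≡ + desAlong (orient G₁) (λ x → σ (root x))
  rootDescents-desAlong σ =
    trans (∑∑-combine n₁ n₂ _)
          (trans (∑-cong n₁ (λ x → trans (∑-cong n₂ (λ y → trans (∑-cong n₁ (λ x′ →
                                            trans (∑-cong n₂ (λ y′ → at-roots x y x′ y′))
                                                  (trans (∑-if n₂ (y ≟ᵇ v) (λ y′ → if y′ ≟ᵇ v then g x x′ else 0ℤ))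
                                                         (cong (λ z → if y ≟ᵇ v then z else 0ℤ) (∑-δ n₂ v (λ _ → g x x′))))))
                                                              (∑-if n₁ (y ≟ᵇ v) (g x))))
                                         (∑-δ n₂ v (λ _ → ∑[ x′ < n₁ ] g x x′))))
                 (sym (desAlong-ℤ (orient G₁) (λ x → σ (root x)))))
    where
    g : Fin n₁ → Fin n₁ → ℤ
    g x x′ = 𝟙 (orient G₁ x x′ ∧ (toℕ (σ (root x′)) <ᵇ toℕ (σ (root x))))
    at-roots : ∀ x y x′ y′ →
      𝟙 ((rootEdge (remQuot {n₁} n₂ (combine x y)) (remQuot {n₁} n₂ (combine x′ y′)) ∧ (toℕ (combine {n₁} {n₂} x y) <ᵇ toℕ (combine {n₁} {n₂} x′ y′)))
         ∧ (toℕ (σ (combine x′ y′)) <ᵇ toℕ (σ (combine x y))))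
      ≡ (if y ≟ᵇ v then (if y′ ≟ᵇ v then g x x′ else 0ℤ) else 0ℤ)
    at-roots x y x′ y′ =
      trans (cong (λ z → 𝟙 ((z ∧ (toℕ (combine {n₁} {n₂} x y) <ᵇ toℕ (combine {n₁} {n₂} x′ y′))) ∧ (toℕ (σ (combine x′ y′)) <ᵇ toℕ (σ (combine x y)))))
                  (cong₂ rootEdge (FinP.remQuot-combine x y) (FinP.remQuot-combine x′ y′)))
            (cases (y FinP.≟ v) (y′ FinP.≟ v))
      where
      cases : ∀ (d : Dec (y ≡ v)) (d′ : Dec (y′ ≡ v)) →
        𝟙 ((((isYes d ∧ isYes d′) ∧ adj G₁ x x′) ∧ (toℕ (combine {n₁} {n₂} x y) <ᵇ toℕ (combine {n₁} {n₂} x′ y′)))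
           ∧ (toℕ (σ (combine x′ y′)) <ᵇ toℕ (σ (combine x y))))
        ≡ (if isYes d then (if isYes d′ then g x x′ else 0ℤ) else 0ℤ)
      cases (no _)     _          = refl
      cases (yes refl) (no _)     = refl
      cases (yes refl) (yes refl) rewrite combine-<ᵇ-root x x′ = refl

  des-split : ∀ σ → des (orient (rootedProduct G₁ G₂ v)) σ ≡ des (orient copies) σ ℕ.+ desAlong (orient G₁) (λ x → σ (root x))
  des-split σ = ℤP.+-injective (begin
      + des (orient (rootedProduct G₁ G₂ v)) σ
    ≡⟨ des-ℤ _ σ ⟩
      ∑[ p < N ] ∑[ q < N ] 𝟙 (orient (rootedProduct G₁ G₂ v) p q ∧ (toℕ (σ q) <ᵇ toℕ (σ p)))
    ≡⟨ trans (∑-cong N (λ p → trans (∑-cong N (split p)) (∑-distrib-+ {N} _ _))) (∑-distrib-+ {N} _ _) ⟩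
      ∑[ p < N ] ∑[ q < N ] 𝟙 (orient copies p q ∧ (toℕ (σ q) <ᵇ toℕ (σ p))) ℤ.+ rootDescents σ
    ≡⟨ cong₂ ℤ._+_ (sym (des-ℤ (orient copies) σ)) (rootDescents-desAlong σ) ⟩
      + des (orient copies) σ ℤ.+ + desAlong (orient G₁) (λ x → σ (root x))
    ≡⟨ sym (ℤP.pos-+ (des (orient copies) σ) _) ⟩
      + (des (orient copies) σ ℕ.+ desAlong (orient G₁) (λ x → σ (root x)))
    ∎)
    where
    open ≡-Reasoning
    split : ∀ p q → 𝟙 (orient (rootedProduct G₁ G₂ v) p q ∧ (toℕ (σ q) <ᵇ toℕ (σ p)))
                  ≡ 𝟙 (orient copies p q ∧ (toℕ (σ q) <ᵇ toℕ (σ p)))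
                    ℤ.+ 𝟙 ((rootEdge (remQuot {n₁} n₂ p) (remQuot {n₁} n₂ q) ∧ (toℕ p <ᵇ toℕ q)) ∧ (toℕ (σ q) <ᵇ toℕ (σ p)))
    split p q =
      trans (𝟙-∨-disjoint (copyEdge s t) (rootEdge s t) _ _ (copyEdge⇒¬rootEdge s t))
            (cong (λ z → 𝟙 ((z ∧ (toℕ p <ᵇ toℕ q)) ∧ (toℕ (σ q) <ᵇ toℕ (σ p))) ℤ.+ _) (sym (pairAdj-edgeless s t)))
      where
      s = remQuot {n₁} n₂ p
      t = remQuot {n₁} n₂ q

  relabel : (Fin n₁ → Fin n₁) → Fin N → Fin N
  relabel φ p = combine (φ (proj₁ (remQuot {n₁} n₂ p))) (proj₂ (remQuot {n₁} n₂ p))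

  relabel-combine : ∀ φ x y → relabel φ (combine x y) ≡ combine (φ x) y
  relabel-combine φ x y = cong (λ t → combine (φ (proj₁ t)) (proj₂ t)) (FinP.remQuot-combine x y)

  relabel-id : ∀ p → relabel (λ x → x) p ≡ p
  relabel-id p = FinP.combine-remQuot {n₁} n₂ p

  relabel-injective : ∀ φ → Injective _≡_ _≡_ φ → Injective _≡_ _≡_ (relabel φ)
  relabel-injective φ φ-inj {p} {q} e =
    trans (sym (relabel-id p)) (trans (cong₂ combine (φ-inj (cong proj₁ coords)) (cong proj₂ coords)) (relabel-id q))
    where
    coords = trans (sym (FinP.remQuot-combine _ _)) (trans (cong (remQuot {n₁} n₂) e) (FinP.remQuot-combine _ _))

  copyDescents : (Fin N → Fin N) → Fin n₁ → ℤ
  copyDescents σ z = ∑[ y < n₂ ] ∑[ y′ < n₂ ] 𝟙 (orient G₂ y y′ ∧ (toℕ (σ (combine z y′)) <ᵇ toℕ (σ (combine z y))))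

  des-copies-relabel-ℤ : ∀ φ σ → + des (orient copies) (λ p → σ (relabel φ p)) ≡ ∑[ x < n₁ ] copyDescents σ (φ x)
  des-copies-relabel-ℤ φ σ =
    trans (des-ℤ (orient copies) (λ p → σ (relabel φ p)))
          (trans (∑∑-combine n₁ n₂ _)
                 (∑-cong n₁ (λ x → trans (∑-comm {n₂} {n₁} _)
                   (trans (∑-cong n₁ (λ x′ → trans (∑-cong n₂ (λ y → trans (∑-cong n₂ (λ y′ → in-copies x y x′ y′)) (∑-if n₂ (x′ ≟ᵇ x) _)))
                                                    (∑-if n₂ (x′ ≟ᵇ x) _)))
                          (∑-δ n₁ x (λ _ → copyDescents σ (φ x)))))))
    where
    in-copies : ∀ x y x′ y′ →
      𝟙 (orient copies (combine x y) (combine x′ y′) ∧ (toℕ (σ (relabel φ (combine x′ y′))) <ᵇ toℕ (σ (relabel φ (combine x y)))))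
      ≡ (if x′ ≟ᵇ x then 𝟙 (orient G₂ y y′ ∧ (toℕ (σ (combine (φ x) y′)) <ᵇ toℕ (σ (combine (φ x) y)))) else 0ℤ)
    in-copies x y x′ y′ =
      trans (cong₂ (λ a b → 𝟙 ((a ∧ (toℕ (combine {n₁} {n₂} x y) <ᵇ toℕ (combine {n₁} {n₂} x′ y′))) ∧ b))
                   (trans (cong₂ (pairAdj (edgeless n₁) G₂ v) (FinP.remQuot-combine x y) (FinP.remQuot-combine x′ y′)) (pairAdj-edgeless (x , y) (x′ , y′)))
                   (cong₂ (λ a b → toℕ (σ a) <ᵇ toℕ (σ b)) (relabel-combine φ x′ y′) (relabel-combine φ x y)))
            (cases (x′ FinP.≟ x))
      where
      cases : ∀ (d : Dec (x′ ≡ x)) →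
        𝟙 ((copyEdge (x , y) (x′ , y′) ∧ (toℕ (combine {n₁} {n₂} x y) <ᵇ toℕ (combine {n₁} {n₂} x′ y′))) ∧ (toℕ (σ (combine (φ x′) y′)) <ᵇ toℕ (σ (combine (φ x) y))))
        ≡ (if isYes d then 𝟙 (orient G₂ y y′ ∧ (toℕ (σ (combine (φ x) y′)) <ᵇ toℕ (σ (combine (φ x) y)))) else 0ℤ)
      cases (yes refl) rewrite ≡⇒≟ᵇ {x = x′} refl | combine-<ᵇ-copy x′ y y′ = refl
      cases (no x′≢x) rewrite ≢⇒≟ᵇ {x = x} {x′} (λ e → x′≢x (sym e)) = refl

  des-copies-relabel : ∀ α → Injective _≡_ _≡_ α → ∀ σ → des (orient copies) (λ p → σ (relabel α p)) ≡ des (orient copies) σ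
  des-copies-relabel α α-inj σ = ℤP.+-injective (begin
      + des (orient copies) (λ p → σ (relabel α p))
    ≡⟨ des-copies-relabel-ℤ α σ ⟩
      ∑[ x < n₁ ] copyDescents σ (α x)
    ≡⟨ ∑-reindex n₁ α α-inj (copyDescents σ) ⟩
      ∑[ x < n₁ ] copyDescents σ x
    ≡⟨ sym (des-copies-relabel-ℤ (λ x → x) σ) ⟩
      + des (orient copies) (λ p → σ (relabel (λ x → x) p))
    ≡⟨ cong +_ (des-≗ (orient copies) _ σ (λ p → cong σ (relabel-id p))) ⟩
      + des (orient copies) σ
    ∎)
    where open ≡-Reasoning

  A₋₁-relabel : ∀ α → Injective _≡_ _≡_ α →
    A₋₁ (rootedProduct G₁ G₂ v) ≡ ∑[ σ ∈ bijections N ] (sgn (des (orient copies) σ) ℤ.* sgn (desAlong (orient G₁) (λ x → σ (root (α x)))))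
  A₋₁-relabel α α-inj =
    trans (∑-bij-∘ʳ N (relabel α) (relabel-injective α α-inj) _ (sgn-des-respects _))
          (∑ˡ-cong (bijections N) (λ σ → trans (cong sgn (trans (des-split (λ p → σ (relabel α p)))
                                                                (cong₂ ℕ._+_ (des-copies-relabel α α-inj σ) (at-roots σ))))
                                              (sgn-+ (des (orient copies) σ) (desAlong (orient G₁) (λ x → σ (root (α x)))))))
    where
    at-roots : ∀ σ → desAlong (orient G₁) (λ x → σ (relabel α (root x))) ≡ desAlong (orient G₁) (λ x → σ (root (α x)))
    at-roots σ = desAlong-order (orient G₁) (λ x → σ (relabel α (root x))) (λ x → σ (root (α x))) (λ a b → cong₂ (λ s t → toℕ (σ s) <ᵇ toℕ (σ t)) (relabel-combine α a v) (relabel-combine α b v))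

  -- Relabelling the copies by α fixes their descents and moves the roots by α; averaging over the n₁! choices
  -- of α turns the descents between the roots into those of the bijections of V(G₁).
  A₋₁-average : + (n₁ !) ℤ.* A₋₁ (rootedProduct G₁ G₂ v) ≡ A₋₁ copies ℤ.* A₋₁ G₁
  A₋₁-average = begin
      + (n₁ !) ℤ.* A₋₁ (rootedProduct G₁ G₂ v)
    ≡⟨ sym (∑-bij-const n₁ _) ⟩
      ∑[ α ∈ bijections n₁ ] A₋₁ (rootedProduct G₁ G₂ v)
    ≡⟨ ∑-bij-cong n₁ _ _ A₋₁-relabel ⟩
      ∑[ α ∈ bijections n₁ ] ∑[ σ ∈ bijections N ] (g σ ℤ.* h σ α)
    ≡⟨ ∑ˡ-comm (bijections n₁) (bijections N) _ ⟩
      ∑[ σ ∈ bijections N ] ∑[ α ∈ bijections n₁ ] (g σ ℤ.* h σ α)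
    ≡⟨ ∑ˡ-cong (bijections N) (λ σ → *-distribˡ-∑ˡ (bijections n₁) (g σ) (h σ)) ⟩
      ∑[ σ ∈ bijections N ] (g σ ℤ.* ∑[ α ∈ bijections n₁ ] h σ α)
    ≡⟨ ∑-bij-cong N _ _ (λ σ σ-inj → cong (g σ ℤ.*_) (∑-bij-desAlong (orient G₁) (λ x → σ (root x)) (λ e → root-injective (σ-inj e)))) ⟩
      ∑[ σ ∈ bijections N ] (g σ ℤ.* A₋₁ G₁)
    ≡⟨ trans (∑ˡ-cong (bijections N) (λ σ → ℤP.*-comm (g σ) (A₋₁ G₁))) (trans (*-distribˡ-∑ˡ (bijections N) (A₋₁ G₁) g) (ℤP.*-comm (A₋₁ G₁) _)) ⟩
      A₋₁ copies ℤ.* A₋₁ G₁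
    ∎
    where
    open ≡-Reasoning
    g : (Fin N → Fin N) → ℤ
    g σ = sgn (des (orient copies) σ)
    h : (Fin N → Fin N) → (Fin n₁ → Fin n₁) → ℤ
    h σ α = sgn (desAlong (orient G₁) (λ x → σ (root (α x))))

module Copies {n₂ : ℕ} (G₂ : Graph n₂) (v : Fin n₂) where

  copies : ∀ k → Graph (k * n₂)
  copies k = rootedProduct (edgeless k) G₂ v

  suc-≟ᵇ : ∀ {m} (a b : Fin m) → (Fin.suc a ≟ᵇ Fin.suc b) ≡ (a ≟ᵇ b)
  suc-≟ᵇ a b = ≟ᵇ-cong FinP.suc-injective (cong Fin.suc)

  -- the first copy is split off by splitAt, exactly as in combine2
  adj-copies-suc : ∀ k p q → adj (copies (suc k)) p q ≡ adj (combine2 false G₂ (copies k)) p q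
  adj-copies-suc k p q =
    trans (RootedProduct.pairAdj-edgeless (edgeless (suc k)) G₂ v (remQuot {suc k} n₂ p) (remQuot {suc k} n₂ q))
          (by-parts (splitAt n₂ p) (splitAt n₂ q) refl refl)
    where
    by-parts : ∀ s t → splitAt n₂ p ≡ s → splitAt n₂ q ≡ t →
      RootedProduct.copyEdge (edgeless (suc k)) G₂ v (remQuot {suc k} n₂ p) (remQuot {suc k} n₂ q)
        ≡ twoAdj false G₂ (copies k) (splitAt n₂ p) (splitAt n₂ q)
    by-parts (inj₁ y) (inj₁ y′) e₁ e₂ rewrite e₁ | e₂ = refl
    by-parts (inj₁ y) (inj₂ j)  e₁ e₂ rewrite e₁ | e₂ = refl
    by-parts (inj₂ j) (inj₁ y)  e₁ e₂ rewrite e₁ | e₂ = refl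
    by-parts (inj₂ j) (inj₂ j′) e₁ e₂ rewrite e₁ | e₂ =
      trans (cong (_∧ adj G₂ (proj₂ (remQuot {k} n₂ j)) (proj₂ (remQuot {k} n₂ j′))) (suc-≟ᵇ (proj₁ (remQuot {k} n₂ j)) (proj₁ (remQuot {k} n₂ j′))))
            (sym (RootedProduct.pairAdj-edgeless (edgeless k) G₂ v (remQuot {k} n₂ j) (remQuot {k} n₂ j′)))

  totalSize-replicate : ∀ k → totalSize (replicate k (n₂ , G₂)) ≡ k * n₂
  totalSize-replicate zero    = refl
  totalSize-replicate (suc k) = cong (n₂ ℕ.+_) (totalSize-replicate k)

  A₋₁-copies : ∀ k → A₋₁ (copies k) ≡ A₋₁ (disjointUnion (replicate k (n₂ , G₂)))
  A₋₁-copies zero    = refl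
  A₋₁-copies (suc k) = begin
      A₋₁ (copies (suc k))
    ≡⟨ A₋₁-cong (copies (suc k)) (combine2 false G₂ (copies k)) (adj-copies-suc k) ⟩
      A₋₁ (combine2 false G₂ (copies k))
    ≡⟨ A₋₁-combine2 false n₂ (k * n₂) G₂ (copies k) ⟩
      evalP (qBinomial n₂ (k * n₂)) 1ℤ ℤ.* (A₋₁ G₂ ℤ.* A₋₁ (copies k))
    ≡⟨ cong₂ (λ m z → evalP (qBinomial n₂ m) 1ℤ ℤ.* (A₋₁ G₂ ℤ.* z)) (sym (totalSize-replicate k)) (A₋₁-copies k) ⟩
      evalP (qBinomial n₂ (totalSize rest)) 1ℤ ℤ.* (A₋₁ G₂ ℤ.* A₋₁ (disjointUnion rest))
    ≡⟨ sym (A₋₁-combine2 false n₂ (totalSize rest) G₂ (disjointUnion rest)) ⟩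
      A₋₁ (disjointUnion (replicate (suc k) (n₂ , G₂)))
    ∎
    where
    open ≡-Reasoning
    rest = replicate k (n₂ , G₂)

ν-rootedProduct : ∀ (n₁ n₂ : ℕ) (G₁ : Graph n₁) (G₂ : Graph n₂) (v : Fin n₂) (M : ℕ) →
  M * product (replicate n₁ (n₂ !)) ≡ (n₁ * n₂) ! →
  n₁ ! * ν (rootedProduct G₁ G₂ v) ≡ M * ν G₁ * ν G₂ ^ n₁
ν-rootedProduct n₁ n₂ G₁ G₂ v M M-spec = begin
    n₁ ! * ∣ A₋₁ (rootedProduct G₁ G₂ v) ∣
  ≡⟨ sym (ℤP.abs-* (+ (n₁ !)) _) ⟩
    ∣ + (n₁ !) ℤ.* A₋₁ (rootedProduct G₁ G₂ v) ∣
  ≡⟨ cong ∣_∣ (trans (RootedProduct.A₋₁-average G₁ G₂ v) (cong (ℤ._* A₋₁ G₁) (Copies.A₋₁-copies G₂ v n₁))) ⟩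
    ∣ A₋₁ (disjointUnion reps) ℤ.* A₋₁ G₁ ∣
  ≡⟨ trans (ℤP.abs-* (A₋₁ (disjointUnion reps)) (A₋₁ G₁)) (cong (_* ν G₁) (ν-disjointUnion reps M reps-spec)) ⟩
    M * product (map (λ p → ν (proj₂ p)) reps) * ν G₁
  ≡⟨ cong (λ z → M * z * ν G₁) (trans (cong product (map-replicate (λ p → ν (proj₂ p)) n₁ (n₂ , G₂))) (product-replicate n₁ (ν G₂))) ⟩
    M * ν G₂ ^ n₁ * ν G₁
  ≡⟨ trans (ℕP.*-assoc M _ _) (trans (cong (M *_) (ℕP.*-comm (ν G₂ ^ n₁) (ν G₁))) (sym (ℕP.*-assoc M _ _))) ⟩
    M * ν G₁ * ν G₂ ^ n₁
  ∎
  where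
  open ≡-Reasoning
  reps = replicate n₁ (n₂ , G₂)
  product-replicate : ∀ k a → product (replicate k a) ≡ a ^ k
  product-replicate zero    a = refl
  product-replicate (suc k) a = cong (a *_) (product-replicate k a)
  reps-spec : M * product (map (λ p → proj₁ p !) reps) ≡ totalSize reps !
  reps-spec = trans (cong (λ l → M * product l) (map-replicate (λ p → proj₁ p !) n₁ (n₂ , G₂)))
                    (trans M-spec (cong _! (sym (Copies.totalSize-replicate G₂ v n₁))))

proposition3p6 :
    (∀ (n : ℕ) (G : Graph n) → ν G ≤ η G)
    × (∀ (m : ℕ) (G : Graph (suc m)) →
         ν G ≤ sum (map (λ v → ν (deleteV G v)) (allFin (suc m))))
    × (∀ (Gs : List (Σ ℕ Graph)) (M : ℕ) →
         M * product (map (λ p → proj₁ p !) Gs) ≡ totalSize Gs ! →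
         ν (disjointUnion Gs) ≡ M * product (map (λ p → ν (proj₂ p)) Gs))
    × (∀ (Gs : List (Σ ℕ Graph)) (P : Poly) →
         (P *ₚ productP (map (λ p → qFact (proj₁ p)) Gs)) ≈ₚ qFact (totalSize Gs) →
         ν (join Gs) ≡ ∣ evalP P (- (+ 1)) ∣ * product (map (λ p → ν (proj₂ p)) Gs))
    × (∀ (n₁ n₂ : ℕ) (G₁ : Graph n₁) (G₂ : Graph n₂) (v : Fin n₂) (M : ℕ) →
         M * product (replicate n₁ (n₂ !)) ≡ (n₁ * n₂) ! →
         n₁ ! * ν (rootedProduct G₁ G₂ v) ≡ M * ν G₁ * ν G₂ ^ n₁)
proposition3p6 = ν≤η , ν-deleteV , ν-disjointUnion , ν-join , ν-rootedProduct
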